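{- Let $n \geq 2$ and $p = \lfloor \frac{n+1}{2}\rfloor$, and let $g = am - pc$. Then in $\mathrm{OS}_n$: (1) $\partial(a) = \binom{n}{2}$; (2) $\partial(m) = n$; (3) $\partial(am) = -na + \binom{n}{2}m$; (4) $\partial(c^d) = -2d\,ac^{d-1} + d(n-1)\,mc^{d-1}$ for every integer $d \geq 1$; (5) $\partial(amc^d) = -n\,ac^d + \binom{n}{2}\,mc^d$ for every integer $d \geq 0$; (6) $\partial(g) = 0$ if $n$ is even and $\partial(g) = a - (p-1)m$ if $n$ is odd. (Here integers in degree $0$ are identified with multiples of $1 \in \mathrm{OS}_n$.)
   Context: $\mathrm{OS}_n$ is the quotient of the exterior algebra $E$ over $\mathbb{Q}$ on generators $e_{ij}$, $1 \leq i < j \leq n+1$ (each of degree $1$), by the two-sided ideal generated by $e_{ik}e_{jk} - e_{ij}e_{jk} + e_{ij}e_{ik}$ for $1 \leq i<j<k \leq n+1$. The linear map $\hat\partial : E \to E$ defined on monomials by $\hat\partial(e_{i_1j_1}\cdots e_{i_dj_d}) = \sum_{k=1}^d (-1)^{k+1} e_{i_1j_1}\cdots \widehat{e_{i_kj_k}}\cdots e_{i_dj_d}$ (omitting the $k$-th factor; $\hat\partial(1)=0$) descends to a linear map $\partial: \mathrm{OS}_n \to \mathrm{OS}_n$. Define $a = \sum_{1\leq i<j\leq n} e_{ij}$, $m = \sum_{1 \leq i \leq n} e_{i,n+1}$, and $c = \sum_{1 \leq i<j\leq n}\big(e_{ij}e_{i,n+1} + e_{ij}e_{j,n+1}\big)$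 in $\mathrm{OS}_n$. -}

module Defs where

open import Data.Nat as ℕ using (ℕ; zero; suc; _<?_; _≡ᵇ_)
open import Data.Nat.Properties as ℕP using ()
open import Data.Fin as Fin using (Fin; toℕ; fromℕ)
open import Data.Fin.Properties using (toℕ-fromℕ)
open import Data.List using (List; []; _∷_; _++_; map; concatMap; length; removeAt; allFin)
open import Data.Product using (Σ; _×_; _,_)
open import Data.Bool using (Bool; true; false; _∧_; if_then_else_)
open import Data.Integer using (+_)
open import Data.Rational using (ℚ; 0ℚ; 1ℚ; _+_; _*_; -_) renaming (_/_ to _÷_)
open import Relation.Nullary using (yes; no)
open import Relation.Binary.PropositionalEquality using (_≡_; subst; sym)

-- Generators e_{ij} of OS_n, 1 ≤ i < j ≤ n+1, encoded 0-indexed: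
-- i j : Fin (suc n) with toℕ i < toℕ j  (e_{ij} ↔ gen (i-1) (j-1)).
record Gen (n : ℕ) : Set where
  constructor gen
  field
    i j : Fin (suc n)
    i<j : toℕ i ℕ.< toℕ j
open Gen public

Word : ℕ → Set
Word n = List (Gen n)

-- Elements of the free associative ℚ-algebra on the generators, as formal
-- finite ℚ-linear combinations of words.
Poly : ℕ → Set
Poly n = List (ℚ × Word n)

eqG : ∀ {n} → Gen n → Gen n → Bool
eqG x y = (toℕ (i x) ≡ᵇ toℕ (i y)) ∧ (toℕ (j x) ≡ᵇ toℕ (j y))

eqW : ∀ {n} → Word n → Word n → Bool
eqW []       []       = true
eqW (x ∷ u)  (y ∷ v)  = eqG x y ∧ eqW u v
eqW _        _        = false

coeff : ∀ {n} → Poly n → Word n → ℚ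
coeff []            w = 0ℚ
coeff ((q , u) ∷ p) w = if eqW u w then q + coeff p w else coeff p w

ℕ→ℚ : ℕ → ℚ
ℕ→ℚ k = (+ k) ÷ 1

_⊕_ : ∀ {n} → Poly n → Poly n → Poly n
p ⊕ q = p ++ q

_·_ : ∀ {n} → ℚ → Poly n → Poly n
r · p = map (λ { (q , u) → (r * q , u) }) p

_⊖_ : ∀ {n} → Poly n → Poly n → Poly n
p ⊖ q = p ++ ((- 1ℚ) · q)

_⊛_ : ∀ {n} → Poly n → Poly n → Poly n
p ⊛ q = concatMap (λ { (a , u) → map (λ { (b , v) → (a * b , u ++ v) }) q }) p

const : ∀ {n} → ℚ → Poly n
const q = (q , []) ∷ []

zeroP : ∀ {n} → Poly n
zeroP = []

mono : ∀ {n} → Word n → Poly n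
mono u = (1ℚ , u) ∷ []

e : ∀ {n} → Gen n → Poly n
e x = mono (x ∷ [])

_^_ : ∀ {n} → Poly n → ℕ → Poly n
p ^ zero  = const 1ℚ
p ^ suc d = p ⊛ (p ^ d)

-- ∂̂ on monomials: ∂̂(x₁⋯x_d) = Σ_{k=1}^{d} (-1)^{k+1} x₁⋯x̂_k⋯x_d
-- (here k is 0-indexed, so the sign is (-1)^k).
sgn : ℕ → ℚ
sgn zero    = 1ℚ
sgn (suc k) = - sgn k

∂w : ∀ {n} → Word n → Poly n
∂w w = map (λ k → (sgn (toℕ k) , removeAt w k)) (allFin (length w))

∂̂ : ∀ {n} → Poly n → Poly n
∂̂ p = concatMap (λ { (q , w) → q · ∂w w }) p

-- Generators of the two-sided ideal: exterior relations (x y + y x, x x)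
-- and the Orlik–Solomon relations e_ik e_jk - e_ij e_jk + e_ij e_ik, i<j<k.
data Rel (n : ℕ) : Set where
  anti : Gen n → Gen n → Rel n
  sq   : Gen n → Rel n
  os   : (a b c : Fin (suc n)) → toℕ a ℕ.< toℕ b → toℕ b ℕ.< toℕ c → Rel n

relPoly : ∀ {n} → Rel n → Poly n
relPoly (anti x y) = mono (x ∷ y ∷ []) ⊕ mono (y ∷ x ∷ [])
relPoly (sq x)     = mono (x ∷ x ∷ [])
relPoly (os a b c a<b b<c) =
  let eik = gen a c (ℕP.<-trans a<b b<c)
      ejk = gen b c b<c
      eij = gen a b a<b
  in (mono (eik ∷ ejk ∷ []) ⊖ mono (eij ∷ ejk ∷ [])) ⊕ mono (eij ∷ eik ∷ [])

expand : ∀ {n} → List (ℚ × Word n × Rel n × Word n) → Poly n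
expand ts = concatMap (λ { (q , u , r , v) → q · ((mono u ⊛ relPoly r) ⊛ mono v) }) ts

InIdeal : ∀ {n} → Poly n → Set
InIdeal {n} p = Σ (List (ℚ × Word n × Rel n × Word n))
                  (λ ts → ∀ (w : Word n) → coeff p w ≡ coeff (expand ts) w)

infix 4 _≈OS_
_≈OS_ : ∀ {n} → Poly n → Poly n → Set
p ≈OS q = InIdeal (p ⊖ q)

-- The elements a, m, c of OS_n.
-- a = Σ_{1≤i<j≤n} e_ij   (0-indexed: toℕ i < toℕ j < n)
aOS : (n : ℕ) → Poly n
aOS n = concatMap (λ i → concatMap (λ j → f i j) (allFin (suc n))) (allFin (suc n))
  where
  f : Fin (suc n) → Fin (suc n) → Poly n
  f i j with toℕ i <? toℕ j | toℕ j <? n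
  ... | yes i<j | yes _ = e (gen i j i<j)
  ... | _       | _     = []

-- the generator e_{i,n+1} for 1 ≤ i ≤ n (0-indexed i with toℕ i < n)
eLast : ∀ {n} (i : Fin (suc n)) → toℕ i ℕ.< n → Gen n
eLast {n} i i<n = gen i (fromℕ n) (subst (toℕ i ℕ.<_) (sym (toℕ-fromℕ n)) i<n)

-- m = Σ_{1≤i≤n} e_{i,n+1}
mOS : (n : ℕ) → Poly n
mOS n = concatMap f (allFin (suc n))
  where
  f : Fin (suc n) → Poly n
  f i with toℕ i <? n
  ... | yes i<n = e (eLast i i<n)
  ... | no _    = []

-- c = Σ_{1≤i<j≤n} (e_ij e_{i,n+1} + e_ij e_{j,n+1})
cOS : (n : ℕ) → Poly n
cOS n = concatMap (λ i → concatMap (λ j → f i j) (allFin (suc n))) (allFin (suc n))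
  where
  f : Fin (suc n) → Fin (suc n) → Poly n
  f i j with toℕ i <? toℕ j | toℕ j <? n
  ... | yes i<j | yes j<n =
        (e (gen i j i<j) ⊛ e (eLast i (ℕP.<-trans i<j j<n)))
        ⊕ (e (gen i j i<j) ⊛ e (eLast j j<n))
  ... | _       | _     = []

{-# OPTIONS --safe #-}
-- All six identities already hold in the exterior algebra: only the relations xy + yx are
-- used, never the Orlik–Solomon relations.  ∂ is a graded derivation,
-- ∂(pq) = ∂p q + (−1)^k p ∂q for p of degree k, and on degree-one elements it is the sum
-- of the coefficients; this gives (1)–(3), and counting gives ∂c = −2a + (n−1)m.  Since c
-- has even degree it commutes with ∂c, so ∂(c^(d+1)) = (d+1) ∂c c^d, which is (4).  In (5)
-- the second Leibniz term am ∂(c^d) vanishes because am ∂c is a combination of ama and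
-- amm, both zero as a² = m² = 0.  Finally ∂g = ∂(am) − p ∂c, and its coefficients vanish
-- or simplify once n = 2p (n even) or n = 2p − 1 (n odd).
module Submission where

open import Defs
open import Data.Nat using (ℕ; suc; _≤_; _∸_; _/_)
open import Data.Nat.Divisibility using (_∣_)
open import Data.Nat.Combinatorics using (_C_)
open import Data.Product using (_×_)
open import Data.Rational using (ℚ; 1ℚ; _*_; _-_; -_)
open import Relation.Nullary using (¬_)

open import Function using (id; _∘_)
open import Data.Nat as ℕ using (zero; _<_; _<?_; z≤n; s≤s)
import Data.Nat.Properties as ℕP
open import Data.Nat.Combinatorics using (nC1≡n; nCk+nC[k+1]≡[n+1]C[k+1])
open import Data.Nat.DivMod using (_%_; m≡m%n+[m/n]*n; %-remove-+ʳ; m%n<n)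
open import Data.Nat.Divisibility using (divides)
open import Data.Fin as Fin using (Fin; toℕ; fromℕ<)
import Data.Fin.Properties as FinP
open import Data.List using (List; []; _∷_; _++_; map; concatMap; length; allFin; tabulate)
import Data.List.Properties as ListP
open import Data.List.Relation.Unary.All using (All; []; _∷_)
import Data.List.Relation.Unary.All.Properties as AllP
open import Data.Product using (Σ; _,_; proj₁; proj₂)
open import Data.Bool using (true; false; if_then_else_)
open import Data.Rational using (0ℚ; _+_; ½; toℚᵘ)
import Data.Rational.Properties as ℚP
import Data.Rational.Unnormalised as ℚᵘ
import Data.Rational.Unnormalised.Properties as ℚᵘP
import Data.Integer as ℤ
import Data.Integer.Properties as ℤP
open import Data.Rational.Solver using (module +-*-Solver)
open +-*-Solver using (solve; _:+_; _:-_; _:*_; :-_; _:=_; con)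
open import Relation.Nullary using (yes; no; contradiction)
open import Relation.Nullary.Decidable using (recompute)
open import Relation.Binary.Bundles using (Setoid)
open import Relation.Binary.PropositionalEquality
import Relation.Binary.Reasoning.Setoid as SetoidReasoning

-- ℕ→ℚ k normalises + k / 1 through a gcd that is stuck for variable k; ℚᵘ avoids it.
ℕ→ℚ-suc : ∀ k → ℕ→ℚ (suc k) ≡ 1ℚ + ℕ→ℚ k
ℕ→ℚ-suc k = ℚP.toℚᵘ-injective (ℚᵘP.≃-trans (toℚᵘ-ℕ→ℚ (suc k)) (ℚᵘP.≃-trans 1+k≃
  (ℚᵘP.≃-sym (ℚᵘP.≃-trans (ℚP.toℚᵘ-homo-+ 1ℚ (ℕ→ℚ k))
    (ℚᵘP.+-cong {ℚᵘ.1ℚᵘ} {ℚᵘ.1ℚᵘ} ℚᵘP.≃-refl (toℚᵘ-ℕ→ℚ k))))))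
  where
  toℚᵘ-ℕ→ℚ : ∀ k → toℚᵘ (ℕ→ℚ k) ℚᵘ.≃ ℚᵘ.mkℚᵘ (ℤ.+ k) 0
  toℚᵘ-ℕ→ℚ k = ℚP.toℚᵘ-fromℚᵘ (ℚᵘ.mkℚᵘ (ℤ.+ k) 0)
  1+k≃ : ℚᵘ.mkℚᵘ (ℤ.+ suc k) 0 ℚᵘ.≃ ℚᵘ.1ℚᵘ ℚᵘ.+ ℚᵘ.mkℚᵘ (ℤ.+ k) 0
  1+k≃ = ℚᵘ.*≡* (cong (λ x → (ℤ.+ 1 ℤ.+ x) ℤ.* ℤ.+ 1) (sym (ℤP.*-identityʳ (ℤ.+ k))))

ℕ→ℚ-+ : ∀ a b → ℕ→ℚ (a ℕ.+ b) ≡ ℕ→ℚ a + ℕ→ℚ b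
ℕ→ℚ-+ zero    b = sym (ℚP.+-identityˡ (ℕ→ℚ b))
ℕ→ℚ-+ (suc a) b = begin
  ℕ→ℚ (suc (a ℕ.+ b))        ≡⟨ ℕ→ℚ-suc (a ℕ.+ b) ⟩
  1ℚ + ℕ→ℚ (a ℕ.+ b)         ≡⟨ cong (1ℚ +_) (ℕ→ℚ-+ a b) ⟩
  1ℚ + (ℕ→ℚ a + ℕ→ℚ b)       ≡⟨ ℚP.+-assoc 1ℚ (ℕ→ℚ a) (ℕ→ℚ b) ⟨
  1ℚ + ℕ→ℚ a + ℕ→ℚ b         ≡⟨ cong (_+ ℕ→ℚ b) (ℕ→ℚ-suc a) ⟨
  ℕ→ℚ (suc a) + ℕ→ℚ b        ∎
  where open ≡-Reasoning

ℕ→ℚ-* : ∀ a b → ℕ→ℚ (a ℕ.* b) ≡ ℕ→ℚ a * ℕ→ℚ b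
ℕ→ℚ-* zero    b = sym (ℚP.*-zeroˡ (ℕ→ℚ b))
ℕ→ℚ-* (suc a) b = begin
  ℕ→ℚ (b ℕ.+ a ℕ.* b)        ≡⟨ ℕ→ℚ-+ b (a ℕ.* b) ⟩
  ℕ→ℚ b + ℕ→ℚ (a ℕ.* b)      ≡⟨ cong (ℕ→ℚ b +_) (ℕ→ℚ-* a b) ⟩
  ℕ→ℚ b + ℕ→ℚ a * ℕ→ℚ b      ≡⟨ solve 2 (λ a b → b :+ a :* b := (con 1ℚ :+ a) :* b) refl (ℕ→ℚ a) (ℕ→ℚ b) ⟩
  (1ℚ + ℕ→ℚ a) * ℕ→ℚ b       ≡⟨ cong (_* ℕ→ℚ b) (ℕ→ℚ-suc a) ⟨
  ℕ→ℚ (suc a) * ℕ→ℚ b        ∎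
  where open ≡-Reasoning

[1+n]C2≡n+nC2 : ∀ n → suc n C 2 ≡ n ℕ.+ n C 2
[1+n]C2≡n+nC2 n = trans (sym (nCk+nC[k+1]≡[n+1]C[k+1] n 1)) (cong (ℕ._+ n C 2) (nC1≡n n))

2*nC2≡n[n-1] : ∀ n → ℕ→ℚ 2 * ℕ→ℚ (n C 2) ≡ ℕ→ℚ n * (ℕ→ℚ n - 1ℚ)
2*nC2≡n[n-1] zero    = refl
2*nC2≡n[n-1] (suc n) = begin
  ℕ→ℚ 2 * ℕ→ℚ (suc n C 2)                  ≡⟨ cong (λ x → ℕ→ℚ 2 * ℕ→ℚ x) ([1+n]C2≡n+nC2 n) ⟩
  ℕ→ℚ 2 * ℕ→ℚ (n ℕ.+ n C 2)                ≡⟨ cong (ℕ→ℚ 2 *_) (ℕ→ℚ-+ n (n C 2)) ⟩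
  ℕ→ℚ 2 * (ℕ→ℚ n + ℕ→ℚ (n C 2))            ≡⟨ ℚP.*-distribˡ-+ (ℕ→ℚ 2) (ℕ→ℚ n) _ ⟩
  ℕ→ℚ 2 * ℕ→ℚ n + ℕ→ℚ 2 * ℕ→ℚ (n C 2)      ≡⟨ cong (ℕ→ℚ 2 * ℕ→ℚ n +_) (2*nC2≡n[n-1] n) ⟩
  ℕ→ℚ 2 * ℕ→ℚ n + ℕ→ℚ n * (ℕ→ℚ n - 1ℚ)     ≡⟨ regroup (ℕ→ℚ n) ⟩
  (1ℚ + ℕ→ℚ n) * ((1ℚ + ℕ→ℚ n) - 1ℚ)      ≡⟨ cong (λ x → x * (x - 1ℚ)) (ℕ→ℚ-suc n) ⟨
  ℕ→ℚ (suc n) * (ℕ→ℚ (suc n) - 1ℚ)        ∎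
  where
  open ≡-Reasoning
  regroup : ∀ x → ℕ→ℚ 2 * x + x * (x - 1ℚ) ≡ (1ℚ + x) * ((1ℚ + x) - 1ℚ)
  regroup = solve 1 (λ x → con (ℕ→ℚ 2) :* x :+ x :* (x :- con 1ℚ) := (con 1ℚ :+ x) :* ((con 1ℚ :+ x) :- con 1ℚ)) refl

even⇒n≡[1+n]/2*2 : ∀ {n} → 2 ∣ n → n ≡ suc n / 2 ℕ.* 2
even⇒n≡[1+n]/2*2 {n} 2∣n = ℕP.suc-injective
  (trans (m≡m%n+[m/n]*n (suc n) 2) (cong (ℕ._+ suc n / 2 ℕ.* 2) (%-remove-+ʳ 1 2∣n)))

odd⇒1+n≡[1+n]/2*2 : ∀ {n} → ¬ 2 ∣ n → suc n ≡ suc n / 2 ℕ.* 2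
odd⇒1+n≡[1+n]/2*2 {n} 2∤n with suc n % 2 | m%n<n (suc n) 2 | m≡m%n+[m/n]*n (suc n) 2
... | 0           | _            | eq = eq
... | 1           | _            | eq = contradiction (divides (suc n / 2) (ℕP.suc-injective eq)) 2∤n
... | suc (suc _) | s≤s (s≤s ()) | _

ℕ→ℚ-even : ∀ {n} → 2 ∣ n → ℕ→ℚ n ≡ ℕ→ℚ (suc n / 2) * ℕ→ℚ 2
ℕ→ℚ-even {n} 2∣n = trans (cong ℕ→ℚ (even⇒n≡[1+n]/2*2 2∣n)) (ℕ→ℚ-* (suc n / 2) 2)

ℕ→ℚ-odd : ∀ {n} → ¬ 2 ∣ n → ℕ→ℚ n ≡ ℕ→ℚ (suc n / 2) * ℕ→ℚ 2 - 1ℚ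
ℕ→ℚ-odd {n} 2∤n = begin
  ℕ→ℚ n                                ≡⟨ solve 1 (λ x → x := (con 1ℚ :+ x) :- con 1ℚ) refl (ℕ→ℚ n) ⟩
  (1ℚ + ℕ→ℚ n) - 1ℚ                    ≡⟨ cong (_- 1ℚ) (ℕ→ℚ-suc n) ⟨
  ℕ→ℚ (suc n) - 1ℚ                     ≡⟨ cong (λ k → ℕ→ℚ k - 1ℚ) (odd⇒1+n≡[1+n]/2*2 2∤n) ⟩
  ℕ→ℚ (suc n / 2 ℕ.* 2) - 1ℚ           ≡⟨ cong (_- 1ℚ) (ℕ→ℚ-* (suc n / 2) 2) ⟩
  ℕ→ℚ (suc n / 2) * ℕ→ℚ 2 - 1ℚ         ∎
  where open ≡-Reasoning

-- Finite sums

sumBelow : ℕ → (ℕ → ℚ) → ℚ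
sumBelow zero    h = 0ℚ
sumBelow (suc N) h = h 0 + sumBelow N (h ∘ suc)

sumBelow-cong< : ∀ N {h g : ℕ → ℚ} → (∀ k → k < N → h k ≡ g k) → sumBelow N h ≡ sumBelow N g
sumBelow-cong< zero    eq = refl
sumBelow-cong< (suc N) eq = cong₂ _+_ (eq 0 (s≤s z≤n)) (sumBelow-cong< N (λ k k<N → eq (suc k) (s≤s k<N)))

sumBelow-cong : ∀ N {h g : ℕ → ℚ} → (∀ k → h k ≡ g k) → sumBelow N h ≡ sumBelow N g
sumBelow-cong N eq = sumBelow-cong< N (λ k _ → eq k)

sumBelow-suc : ∀ N (h : ℕ → ℚ) → sumBelow (suc N) h ≡ sumBelow N h + h N
sumBelow-suc zero    h = trans (ℚP.+-identityʳ (h 0)) (sym (ℚP.+-identityˡ (h 0)))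
sumBelow-suc (suc N) h = trans (cong (h 0 +_) (sumBelow-suc N (h ∘ suc))) (sym (ℚP.+-assoc (h 0) _ _))

sumBelow-+ : ∀ N (h g : ℕ → ℚ) → sumBelow N (λ k → h k + g k) ≡ sumBelow N h + sumBelow N g
sumBelow-+ zero    h g = refl
sumBelow-+ (suc N) h g = trans (cong (h 0 + g 0 +_) (sumBelow-+ N (h ∘ suc) (g ∘ suc)))
  (solve 4 (λ a b c d → a :+ b :+ (c :+ d) := a :+ c :+ (b :+ d)) refl (h 0) (g 0) _ _)

sumBelow-* : ∀ N c (h : ℕ → ℚ) → sumBelow N (λ k → c * h k) ≡ c * sumBelow N h
sumBelow-* zero    c h = sym (ℚP.*-zeroʳ c)
sumBelow-* (suc N) c h = trans (cong (c * h 0 +_) (sumBelow-* N c (h ∘ suc))) (sym (ℚP.*-distribˡ-+ c (h 0) _))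

sumBelow-+* : ∀ N c (h g : ℕ → ℚ) → sumBelow N (λ k → h k + c * g k) ≡ sumBelow N h + c * sumBelow N g
sumBelow-+* N c h g = trans (sumBelow-+ N h (λ k → c * g k)) (cong (sumBelow N h +_) (sumBelow-* N c g))

sumBelow-0 : ∀ N → sumBelow N (λ _ → 0ℚ) ≡ 0ℚ
sumBelow-0 zero    = refl
sumBelow-0 (suc N) = trans (ℚP.+-identityˡ _) (sumBelow-0 N)

sumBelow-1 : ∀ N → sumBelow N (λ _ → 1ℚ) ≡ ℕ→ℚ N
sumBelow-1 zero    = refl
sumBelow-1 (suc N) = trans (cong (1ℚ +_) (sumBelow-1 N)) (sym (ℕ→ℚ-suc N))

sumBelow-id : ∀ N → sumBelow N ℕ→ℚ ≡ ℕ→ℚ (N C 2)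
sumBelow-id zero    = refl
sumBelow-id (suc N) = begin
  sumBelow (suc N) ℕ→ℚ            ≡⟨ sumBelow-suc N ℕ→ℚ ⟩
  sumBelow N ℕ→ℚ + ℕ→ℚ N          ≡⟨ cong (_+ ℕ→ℚ N) (sumBelow-id N) ⟩
  ℕ→ℚ (N C 2) + ℕ→ℚ N             ≡⟨ ℚP.+-comm _ (ℕ→ℚ N) ⟩
  ℕ→ℚ N + ℕ→ℚ (N C 2)             ≡⟨ ℕ→ℚ-+ N (N C 2) ⟨
  ℕ→ℚ (N ℕ.+ N C 2)               ≡⟨ cong ℕ→ℚ ([1+n]C2≡n+nC2 N) ⟨
  ℕ→ℚ (suc N C 2)                 ∎
  where open ≡-Reasoning

sumBelow-comm : ∀ N M (H : ℕ → ℕ → ℚ) →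
  sumBelow N (λ i → sumBelow M (H i)) ≡ sumBelow M (λ j → sumBelow N (λ i → H i j))
sumBelow-comm zero    M H = sym (sumBelow-0 M)
sumBelow-comm (suc N) M H = trans (cong (sumBelow M (H 0) +_) (sumBelow-comm N M (H ∘ suc)))
  (sym (sumBelow-+ M (H 0) (λ j → sumBelow N (λ i → H (suc i) j))))

sumBelow-vanishing : ∀ M d (h : ℕ → ℚ) → (∀ k → M ≤ k → h k ≡ 0ℚ) →
  sumBelow (M ℕ.+ d) h ≡ sumBelow M h
sumBelow-vanishing M zero    h h≡0 rewrite ℕP.+-identityʳ M = refl
sumBelow-vanishing M (suc d) h h≡0 rewrite ℕP.+-suc M d = begin
  sumBelow (suc (M ℕ.+ d)) h
    ≡⟨ sumBelow-suc (M ℕ.+ d) h ⟩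
  sumBelow (M ℕ.+ d) h + h (M ℕ.+ d)
    ≡⟨ cong₂ _+_ (sumBelow-vanishing M d h h≡0) (h≡0 (M ℕ.+ d) (ℕP.m≤m+n M d)) ⟩
  sumBelow M h + 0ℚ
    ≡⟨ ℚP.+-identityʳ _ ⟩
  sumBelow M h
    ∎
  where open ≡-Reasoning

sumBelow-triangle : ∀ n (V : ℕ → ℕ → ℚ) → (∀ i j → ¬ (i < j × j < n) → V i j ≡ 0ℚ) →
  sumBelow (suc n) (λ i → sumBelow (suc n) (V i)) ≡ sumBelow n (λ j → sumBelow j (λ i → V i j))
sumBelow-triangle n V V≡0 = begin
  sumBelow (suc n) (λ i → sumBelow (suc n) (V i))   ≡⟨ sumBelow-comm (suc n) (suc n) V ⟩
  sumBelow (suc n) column                           ≡⟨ cong (λ N → sumBelow N column) (ℕP.+-comm 1 n) ⟩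
  sumBelow (n ℕ.+ 1) column                         ≡⟨ sumBelow-vanishing n 1 column column≡0 ⟩
  sumBelow n column                                 ≡⟨ sumBelow-cong< n column≡ ⟩
  sumBelow n (λ j → sumBelow j (λ i → V i j))       ∎
  where
  open ≡-Reasoning
  column : ℕ → ℚ
  column j = sumBelow (suc n) (λ i → V i j)
  column≡0 : ∀ j → n ≤ j → column j ≡ 0ℚ
  column≡0 j n≤j = trans (sumBelow-cong (suc n) (λ i → V≡0 i j (ℕP.≤⇒≯ n≤j ∘ proj₂))) (sumBelow-0 (suc n))
  column≡ : ∀ j → j < n → column j ≡ sumBelow j (λ i → V i j)
  column≡ j j<n = trans (cong (λ N → sumBelow N (λ i → V i j)) (sym (ℕP.m+[n∸m]≡n (ℕP.m≤n⇒m≤1+n (ℕP.<⇒≤ j<n)))))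
    (sumBelow-vanishing j (suc n ∸ j) (λ i → V i j) (λ i j≤i → V≡0 i j (ℕP.≤⇒≯ j≤i ∘ proj₁)))

sumBelow-pairs : ∀ N (ψ : ℕ → ℚ) →
  sumBelow N (λ j → sumBelow j (λ i → ψ i + ψ j)) ≡ (ℕ→ℚ N - 1ℚ) * sumBelow N ψ
sumBelow-pairs zero    ψ = sym (ℚP.*-zeroʳ (ℕ→ℚ 0 - 1ℚ))
sumBelow-pairs (suc N) ψ = begin
  sumBelow (suc N) (λ j → sumBelow j (λ i → ψ i + ψ j))
    ≡⟨ sumBelow-suc N (λ j → sumBelow j (λ i → ψ i + ψ j)) ⟩
  sumBelow N (λ j → sumBelow j (λ i → ψ i + ψ j)) + sumBelow N (λ i → ψ i + ψ N)
    ≡⟨ cong₂ _+_ (sumBelow-pairs N ψ) (sumBelow-+ N ψ (λ _ → ψ N)) ⟩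
  (ℕ→ℚ N - 1ℚ) * sumBelow N ψ + (sumBelow N ψ + sumBelow N (λ _ → ψ N))
    ≡⟨ cong (λ x → (ℕ→ℚ N - 1ℚ) * sumBelow N ψ + (sumBelow N ψ + x)) constant-sum ⟩
  (ℕ→ℚ N - 1ℚ) * sumBelow N ψ + (sumBelow N ψ + ℕ→ℚ N * ψ N)
    ≡⟨ regroup (ℕ→ℚ N) (sumBelow N ψ) (ψ N) ⟩
  ((1ℚ + ℕ→ℚ N) - 1ℚ) * (sumBelow N ψ + ψ N)
    ≡⟨ cong₂ (λ x y → (x - 1ℚ) * y) (ℕ→ℚ-suc N) (sumBelow-suc N ψ) ⟨
  (ℕ→ℚ (suc N) - 1ℚ) * sumBelow (suc N) ψ
    ∎
  where
  open ≡-Reasoning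
  constant-sum : sumBelow N (λ _ → ψ N) ≡ ℕ→ℚ N * ψ N
  constant-sum = begin
    sumBelow N (λ _ → ψ N)        ≡⟨ sumBelow-cong N (λ _ → sym (ℚP.*-identityʳ (ψ N))) ⟩
    sumBelow N (λ _ → ψ N * 1ℚ)   ≡⟨ sumBelow-* N (ψ N) (λ _ → 1ℚ) ⟩
    ψ N * sumBelow N (λ _ → 1ℚ)   ≡⟨ cong (ψ N *_) (sumBelow-1 N) ⟩
    ψ N * ℕ→ℚ N                   ≡⟨ ℚP.*-comm (ψ N) (ℕ→ℚ N) ⟩
    ℕ→ℚ N * ψ N                   ∎
  regroup : ∀ x s p → (x - 1ℚ) * s + (s + x * p) ≡ ((1ℚ + x) - 1ℚ) * (s + p)
  regroup = solve 3 (λ x s p → (x :- con 1ℚ) :* s :+ (s :+ x :* p) := ((con 1ℚ :+ x) :- con 1ℚ) :* (s :+ p)) refl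

-- The free algebra

-- Formal combinations are compared through all linear functionals F on words (_≃_ below);
-- the coefficients used by _≈OS_ are the case of a Kronecker delta.
⟦_⟧ : ∀ {n} → Poly n → (Word n → ℚ) → ℚ
⟦ []          ⟧ F = 0ℚ
⟦ (q , u) ∷ p ⟧ F = q * F u + ⟦ p ⟧ F

⟦⟧-++ : ∀ {n} (p q : Poly n) F → ⟦ p ++ q ⟧ F ≡ ⟦ p ⟧ F + ⟦ q ⟧ F
⟦⟧-++ []            q F = sym (ℚP.+-identityˡ (⟦ q ⟧ F))
⟦⟧-++ ((a , u) ∷ p) q F = trans (cong (a * F u +_) (⟦⟧-++ p q F)) (sym (ℚP.+-assoc (a * F u) _ _))

⟦⟧-map : ∀ {n} (g : ℚ × Word n → ℚ × Word n) a (h : Word n → Word n) →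
  (∀ b v → g (b , v) ≡ (a * b , h v)) → ∀ q F → ⟦ map g q ⟧ F ≡ a * ⟦ q ⟧ (F ∘ h)
⟦⟧-map g a h g≡ []            F = sym (ℚP.*-zeroʳ a)
⟦⟧-map g a h g≡ ((b , v) ∷ q) F rewrite g≡ b v =
  trans (cong (a * b * F (h v) +_) (⟦⟧-map g a h g≡ q F))
        (solve 4 (λ a b x y → a :* b :* x :+ a :* y := a :* (b :* x :+ y)) refl a b (F (h v)) _)

⟦⟧-· : ∀ {n} r (p : Poly n) F → ⟦ r · p ⟧ F ≡ r * ⟦ p ⟧ F
⟦⟧-· r = ⟦⟧-map _ r id (λ b v → refl)

⟦⟧-⊖ : ∀ {n} (p q : Poly n) F → ⟦ p ⊖ q ⟧ F ≡ ⟦ p ⟧ F + (- 1ℚ) * ⟦ q ⟧ F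
⟦⟧-⊖ p q F = trans (⟦⟧-++ p ((- 1ℚ) · q) F) (cong (⟦ p ⟧ F +_) (⟦⟧-· (- 1ℚ) q F))

⟦⟧-lincomb : ∀ {n} α β (p q : Poly n) F → ⟦ (α · p) ⊕ (β · q) ⟧ F ≡ α * ⟦ p ⟧ F + β * ⟦ q ⟧ F
⟦⟧-lincomb α β p q F = trans (⟦⟧-++ (α · p) (β · q) F) (cong₂ _+_ (⟦⟧-· α p F) (⟦⟧-· β q F))

⟦⟧-mono : ∀ {n} (u : Word n) F → ⟦ mono u ⟧ F ≡ F u
⟦⟧-mono u F = trans (ℚP.+-identityʳ (1ℚ * F u)) (ℚP.*-identityˡ (F u))

⟦⟧-const : ∀ {n} r (F : Word n → ℚ) → ⟦ const r ⟧ F ≡ r * F []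
⟦⟧-const r F = ℚP.+-identityʳ (r * F [])

⟦⟧-cong : ∀ {n} (p : Poly n) {F G : Word n → ℚ} → (∀ u → F u ≡ G u) → ⟦ p ⟧ F ≡ ⟦ p ⟧ G
⟦⟧-cong []            eq = refl
⟦⟧-cong ((a , u) ∷ p) eq = cong₂ (λ x y → a * x + y) (eq u) (⟦⟧-cong p eq)

⟦⟧-*ᶠ : ∀ {n} (p : Poly n) r F → ⟦ p ⟧ (λ u → r * F u) ≡ r * ⟦ p ⟧ F
⟦⟧-*ᶠ []            r F = sym (ℚP.*-zeroʳ r)
⟦⟧-*ᶠ ((a , u) ∷ p) r F = trans (cong (a * (r * F u) +_) (⟦⟧-*ᶠ p r F))
  (solve 4 (λ r a f l → a :* (r :* f) :+ r :* l := r :* (a :* f :+ l)) refl r a (F u) _)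

⟦⟧-+ᶠ : ∀ {n} (p : Poly n) F G → ⟦ p ⟧ (λ u → F u + G u) ≡ ⟦ p ⟧ F + ⟦ p ⟧ G
⟦⟧-+ᶠ []            F G = refl
⟦⟧-+ᶠ ((a , u) ∷ p) F G = trans (cong (a * (F u + G u) +_) (⟦⟧-+ᶠ p F G))
  (solve 5 (λ a f g x y → a :* (f :+ g) :+ (x :+ y) := (a :* f :+ x) :+ (a :* g :+ y)) refl a (F u) (G u) _ _)

⟦⟧-0ᶠ : ∀ {n} (p : Poly n) → ⟦ p ⟧ (λ _ → 0ℚ) ≡ 0ℚ
⟦⟧-0ᶠ []            = refl
⟦⟧-0ᶠ ((a , u) ∷ p) = trans (cong₂ _+_ (ℚP.*-zeroʳ a) (⟦⟧-0ᶠ p)) (ℚP.+-identityˡ 0ℚ)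

⟦⟧-swap : ∀ {n} (p q : Poly n) (H : Word n → Word n → ℚ) →
  ⟦ p ⟧ (λ u → ⟦ q ⟧ (H u)) ≡ ⟦ q ⟧ (λ v → ⟦ p ⟧ (λ u → H u v))
⟦⟧-swap []            q H = sym (⟦⟧-0ᶠ q)
⟦⟧-swap ((a , u) ∷ p) q H = begin
  a * ⟦ q ⟧ (H u) + ⟦ p ⟧ (λ u → ⟦ q ⟧ (H u))
    ≡⟨ cong₂ _+_ (sym (⟦⟧-*ᶠ q a (H u))) (⟦⟧-swap p q H) ⟩
  ⟦ q ⟧ (λ v → a * H u v) + ⟦ q ⟧ (λ v → ⟦ p ⟧ (λ u → H u v))
    ≡⟨ ⟦⟧-+ᶠ q (λ v → a * H u v) (λ v → ⟦ p ⟧ (λ u → H u v)) ⟨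
  ⟦ q ⟧ (λ v → a * H u v + ⟦ p ⟧ (λ u → H u v))
    ∎
  where open ≡-Reasoning

⟦⟧-⊛ : ∀ {n} (p q : Poly n) F → ⟦ p ⊛ q ⟧ F ≡ ⟦ p ⟧ (λ u → ⟦ q ⟧ (λ v → F (u ++ v)))
⟦⟧-⊛ []            q F = refl
⟦⟧-⊛ ((a , u) ∷ p) q F = trans (⟦⟧-++ (map _ q) (p ⊛ q) F)
  (cong₂ _+_ (⟦⟧-map _ a (u ++_) (λ b v → refl) q F) (⟦⟧-⊛ p q F))

⟦⟧-mono-⊛ : ∀ {n} (u : Word n) p F → ⟦ mono u ⊛ p ⟧ F ≡ ⟦ p ⟧ (λ x → F (u ++ x))
⟦⟧-mono-⊛ u p F = trans (⟦⟧-⊛ (mono u) p F) (⟦⟧-mono u (λ y → ⟦ p ⟧ (λ x → F (y ++ x))))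

⟦⟧-⊛-mono : ∀ {n} (p : Poly n) v F → ⟦ p ⊛ mono v ⟧ F ≡ ⟦ p ⟧ (λ y → F (y ++ v))
⟦⟧-⊛-mono p v F = trans (⟦⟧-⊛ p (mono v) F) (⟦⟧-cong p (λ y → ⟦⟧-mono v (λ w → F (y ++ w))))

⟦⟧-∂̂ : ∀ {n} (p : Poly n) F → ⟦ ∂̂ p ⟧ F ≡ ⟦ p ⟧ (λ u → ⟦ ∂w u ⟧ F)
⟦⟧-∂̂ []            F = refl
⟦⟧-∂̂ ((a , u) ∷ p) F = trans (⟦⟧-++ (a · ∂w u) (∂̂ p) F) (cong₂ _+_ (⟦⟧-· a (∂w u) F) (⟦⟧-∂̂ p F))

⟦⟧-concatMap-tabulate : ∀ {n} {A : Set} N (g : A → Poly n) (t : Fin N → A) (h : ℕ → ℚ) F →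
  (∀ i → ⟦ g (t i) ⟧ F ≡ h (toℕ i)) → ⟦ concatMap g (tabulate t) ⟧ F ≡ sumBelow N h
⟦⟧-concatMap-tabulate zero    g t h F eq = refl
⟦⟧-concatMap-tabulate (suc N) g t h F eq = trans (⟦⟧-++ (g (t Fin.zero)) _ F)
  (cong₂ _+_ (eq Fin.zero) (⟦⟧-concatMap-tabulate N g (t ∘ Fin.suc) (h ∘ suc) F (eq ∘ Fin.suc)))

infix 4 _≃_
record _≃_ {n : ℕ} (p q : Poly n) : Set where
  constructor mk≃
  field ⟦⟧-≡ : ∀ F → ⟦ p ⟧ F ≡ ⟦ q ⟧ F
open _≃_ public

≃-refl : ∀ {n} {p : Poly n} → p ≃ p
≃-refl = mk≃ λ F → refl

≃-sym : ∀ {n} {p q : Poly n} → p ≃ q → q ≃ p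
≃-sym p≃q = mk≃ λ F → sym (⟦⟧-≡ p≃q F)

≃-trans : ∀ {n} {p q r : Poly n} → p ≃ q → q ≃ r → p ≃ r
≃-trans p≃q q≃r = mk≃ λ F → trans (⟦⟧-≡ p≃q F) (⟦⟧-≡ q≃r F)

⊕-cong : ∀ {n} {p p′ q q′ : Poly n} → p ≃ p′ → q ≃ q′ → p ⊕ q ≃ p′ ⊕ q′
⊕-cong {p = p} {p′} {q} {q′} p≃p′ q≃q′ = mk≃ λ F →
  trans (⟦⟧-++ p q F) (trans (cong₂ _+_ (⟦⟧-≡ p≃p′ F) (⟦⟧-≡ q≃q′ F)) (sym (⟦⟧-++ p′ q′ F)))

·-cong : ∀ {n} r {p p′ : Poly n} → p ≃ p′ → r · p ≃ r · p′
·-cong r {p} {p′} p≃p′ = mk≃ λ F →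
  trans (⟦⟧-· r p F) (trans (cong (r *_) (⟦⟧-≡ p≃p′ F)) (sym (⟦⟧-· r p′ F)))

·-identityˡ : ∀ {n} (p : Poly n) → 1ℚ · p ≃ p
·-identityˡ p = mk≃ λ F → trans (⟦⟧-· 1ℚ p F) (ℚP.*-identityˡ (⟦ p ⟧ F))

⊕-identityʳ : ∀ {n} (p : Poly n) → p ⊕ [] ≃ p
⊕-identityʳ p = mk≃ λ F → cong (λ q → ⟦ q ⟧ F) (ListP.++-identityʳ p)

⊕-·-collect : ∀ {n} k (p : Poly n) → p ⊕ (k · p) ≃ (1ℚ + k) · p
⊕-·-collect k p = mk≃ λ F → begin
  ⟦ p ⊕ (k · p) ⟧ F          ≡⟨ trans (⟦⟧-++ p (k · p) F) (cong (⟦ p ⟧ F +_) (⟦⟧-· k p F)) ⟩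
  ⟦ p ⟧ F + k * ⟦ p ⟧ F      ≡⟨ solve 2 (λ k x → x :+ k :* x := (con 1ℚ :+ k) :* x) refl k (⟦ p ⟧ F) ⟩
  (1ℚ + k) * ⟦ p ⟧ F         ≡⟨ ⟦⟧-· (1ℚ + k) p F ⟨
  ⟦ (1ℚ + k) · p ⟧ F         ∎
  where open ≡-Reasoning

·-lincomb : ∀ {n} k α β (p q : Poly n) → k · ((α · p) ⊕ (β · q)) ≃ ((k * α) · p) ⊕ ((k * β) · q)
·-lincomb k α β p q = mk≃ λ F → begin
  ⟦ k · ((α · p) ⊕ (β · q)) ⟧ F
    ≡⟨ trans (⟦⟧-· k ((α · p) ⊕ (β · q)) F) (cong (k *_) (⟦⟧-lincomb α β p q F)) ⟩
  k * (α * ⟦ p ⟧ F + β * ⟦ q ⟧ F)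
    ≡⟨ solve 5 (λ k α β x y → k :* (α :* x :+ β :* y) := (k :* α) :* x :+ (k :* β) :* y)
               refl k α β (⟦ p ⟧ F) (⟦ q ⟧ F) ⟩
  (k * α) * ⟦ p ⟧ F + (k * β) * ⟦ q ⟧ F
    ≡⟨ ⟦⟧-lincomb (k * α) (k * β) p q F ⟨
  ⟦ ((k * α) · p) ⊕ ((k * β) · q) ⟧ F
    ∎
  where open ≡-Reasoning

⊛-cong : ∀ {n} {p p′ q q′ : Poly n} → p ≃ p′ → q ≃ q′ → p ⊛ q ≃ p′ ⊛ q′
⊛-cong {p = p} {p′} {q} {q′} p≃p′ q≃q′ = mk≃ λ F → begin
  ⟦ p ⊛ q ⟧ F                                ≡⟨ ⟦⟧-⊛ p q F ⟩
  ⟦ p ⟧ (λ u → ⟦ q ⟧ (λ v → F (u ++ v)))     ≡⟨ ⟦⟧-≡ p≃p′ _ ⟩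
  ⟦ p′ ⟧ (λ u → ⟦ q ⟧ (λ v → F (u ++ v)))    ≡⟨ ⟦⟧-cong p′ (λ u → ⟦⟧-≡ q≃q′ (λ v → F (u ++ v))) ⟩
  ⟦ p′ ⟧ (λ u → ⟦ q′ ⟧ (λ v → F (u ++ v)))   ≡⟨ ⟦⟧-⊛ p′ q′ F ⟨
  ⟦ p′ ⊛ q′ ⟧ F                              ∎
  where open ≡-Reasoning

⊛-assoc : ∀ {n} (p q r : Poly n) → (p ⊛ q) ⊛ r ≃ p ⊛ (q ⊛ r)
⊛-assoc p q r = mk≃ λ F → begin
  ⟦ (p ⊛ q) ⊛ r ⟧ F
    ≡⟨ ⟦⟧-⊛ (p ⊛ q) r F ⟩
  ⟦ p ⊛ q ⟧ (λ x → ⟦ r ⟧ (λ z → F (x ++ z)))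
    ≡⟨ ⟦⟧-⊛ p q _ ⟩
  ⟦ p ⟧ (λ u → ⟦ q ⟧ (λ v → ⟦ r ⟧ (λ z → F ((u ++ v) ++ z))))
    ≡⟨ ⟦⟧-cong p (λ u → ⟦⟧-cong q (λ v → ⟦⟧-cong r (λ z → cong F (ListP.++-assoc u v z)))) ⟩
  ⟦ p ⟧ (λ u → ⟦ q ⟧ (λ v → ⟦ r ⟧ (λ z → F (u ++ (v ++ z)))))
    ≡⟨ ⟦⟧-cong p (λ u → ⟦⟧-⊛ q r (λ y → F (u ++ y))) ⟨
  ⟦ p ⟧ (λ u → ⟦ q ⊛ r ⟧ (λ y → F (u ++ y)))
    ≡⟨ ⟦⟧-⊛ p (q ⊛ r) F ⟨
  ⟦ p ⊛ (q ⊛ r) ⟧ F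
    ∎
  where open ≡-Reasoning

⊛-·ʳ : ∀ {n} (p : Poly n) r (q : Poly n) → p ⊛ (r · q) ≃ r · (p ⊛ q)
⊛-·ʳ p r q = mk≃ λ F → begin
  ⟦ p ⊛ (r · q) ⟧ F                                ≡⟨ ⟦⟧-⊛ p (r · q) F ⟩
  ⟦ p ⟧ (λ u → ⟦ r · q ⟧ (λ v → F (u ++ v)))       ≡⟨ ⟦⟧-cong p (λ u → ⟦⟧-· r q _) ⟩
  ⟦ p ⟧ (λ u → r * ⟦ q ⟧ (λ v → F (u ++ v)))       ≡⟨ ⟦⟧-*ᶠ p r _ ⟩
  r * ⟦ p ⟧ (λ u → ⟦ q ⟧ (λ v → F (u ++ v)))       ≡⟨ cong (r *_) (⟦⟧-⊛ p q F) ⟨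
  r * ⟦ p ⊛ q ⟧ F                                  ≡⟨ ⟦⟧-· r (p ⊛ q) F ⟨
  ⟦ r · (p ⊛ q) ⟧ F                                ∎
  where open ≡-Reasoning

⊛-[] : ∀ {n} (p : Poly n) → p ⊛ [] ≃ []
⊛-[] p = mk≃ λ F → trans (⟦⟧-⊛ p [] F) (⟦⟧-0ᶠ p)

⊛-const : ∀ {n} (p : Poly n) r → p ⊛ const r ≃ r · p
⊛-const p r = mk≃ λ F → begin
  ⟦ p ⊛ const r ⟧ F
    ≡⟨ ⟦⟧-⊛ p (const r) F ⟩
  ⟦ p ⟧ (λ u → ⟦ const r ⟧ (λ v → F (u ++ v)))
    ≡⟨ ⟦⟧-cong p (λ u → trans (⟦⟧-const r (λ v → F (u ++ v))) (cong (λ w → r * F w) (ListP.++-identityʳ u))) ⟩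
  ⟦ p ⟧ (λ u → r * F u)
    ≡⟨ ⟦⟧-*ᶠ p r F ⟩
  r * ⟦ p ⟧ F
    ≡⟨ ⟦⟧-· r p F ⟨
  ⟦ r · p ⟧ F
    ∎
  where open ≡-Reasoning

const-⊛ : ∀ {n} r (p : Poly n) → const r ⊛ p ≃ r · p
const-⊛ r p = mk≃ λ F →
  trans (⟦⟧-⊛ (const r) p F) (trans (⟦⟧-const r (λ u → ⟦ p ⟧ (λ v → F (u ++ v)))) (sym (⟦⟧-· r p F)))

lincomb-⊛ : ∀ {n} α β (p q r : Poly n) → ((α · p) ⊕ (β · q)) ⊛ r ≃ (α · (p ⊛ r)) ⊕ (β · (q ⊛ r))
lincomb-⊛ α β p q r = mk≃ λ F → begin
  ⟦ ((α · p) ⊕ (β · q)) ⊛ r ⟧ F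
    ≡⟨ ⟦⟧-⊛ ((α · p) ⊕ (β · q)) r F ⟩
  ⟦ (α · p) ⊕ (β · q) ⟧ (λ u → ⟦ r ⟧ (λ v → F (u ++ v)))
    ≡⟨ ⟦⟧-lincomb α β p q _ ⟩
  α * ⟦ p ⟧ (λ u → ⟦ r ⟧ (λ v → F (u ++ v))) + β * ⟦ q ⟧ (λ u → ⟦ r ⟧ (λ v → F (u ++ v)))
    ≡⟨ cong₂ (λ x y → α * x + β * y) (⟦⟧-⊛ p r F) (⟦⟧-⊛ q r F) ⟨
  α * ⟦ p ⊛ r ⟧ F + β * ⟦ q ⊛ r ⟧ F
    ≡⟨ ⟦⟧-lincomb α β (p ⊛ r) (q ⊛ r) F ⟨
  ⟦ (α · (p ⊛ r)) ⊕ (β · (q ⊛ r)) ⟧ F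
    ∎
  where open ≡-Reasoning

⊛-lincomb : ∀ {n} (r : Poly n) α β (p q : Poly n) → r ⊛ ((α · p) ⊕ (β · q)) ≃ (α · (r ⊛ p)) ⊕ (β · (r ⊛ q))
⊛-lincomb r α β p q = mk≃ λ F → begin
  ⟦ r ⊛ ((α · p) ⊕ (β · q)) ⟧ F
    ≡⟨ ⟦⟧-⊛ r ((α · p) ⊕ (β · q)) F ⟩
  ⟦ r ⟧ (λ u → ⟦ (α · p) ⊕ (β · q) ⟧ (λ v → F (u ++ v)))
    ≡⟨ ⟦⟧-cong r (λ u → ⟦⟧-lincomb α β p q _) ⟩
  ⟦ r ⟧ (λ u → α * ⟦ p ⟧ (λ v → F (u ++ v)) + β * ⟦ q ⟧ (λ v → F (u ++ v)))
    ≡⟨ ⟦⟧-+ᶠ r _ _ ⟩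
  ⟦ r ⟧ (λ u → α * ⟦ p ⟧ (λ v → F (u ++ v))) + ⟦ r ⟧ (λ u → β * ⟦ q ⟧ (λ v → F (u ++ v)))
    ≡⟨ cong₂ _+_ (⟦⟧-*ᶠ r α _) (⟦⟧-*ᶠ r β _) ⟩
  α * ⟦ r ⟧ (λ u → ⟦ p ⟧ (λ v → F (u ++ v))) + β * ⟦ r ⟧ (λ u → ⟦ q ⟧ (λ v → F (u ++ v)))
    ≡⟨ cong₂ (λ x y → α * x + β * y) (⟦⟧-⊛ r p F) (⟦⟧-⊛ r q F) ⟨
  α * ⟦ r ⊛ p ⟧ F + β * ⟦ r ⊛ q ⟧ F
    ≡⟨ ⟦⟧-lincomb α β (r ⊛ p) (r ⊛ q) F ⟨
  ⟦ (α · (r ⊛ p)) ⊕ (β · (r ⊛ q)) ⟧ F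
    ∎
  where open ≡-Reasoning

-- The two-sided ideal

Term : ℕ → Set
Term n = ℚ × Word n × Rel n × Word n

⟦⟧-expand-∷ : ∀ {n} q (u : Word n) r v ts F →
  ⟦ expand ((q , u , r , v) ∷ ts) ⟧ F ≡ q * ⟦ relPoly r ⟧ (λ x → F ((u ++ x) ++ v)) + ⟦ expand ts ⟧ F
⟦⟧-expand-∷ q u r v ts F = trans (⟦⟧-++ (q · ((mono u ⊛ relPoly r) ⊛ mono v)) (expand ts) F)
  (cong (_+ ⟦ expand ts ⟧ F) (trans (⟦⟧-· q ((mono u ⊛ relPoly r) ⊛ mono v) F)
    (cong (q *_) (trans (⟦⟧-⊛-mono (mono u ⊛ relPoly r) v F) (⟦⟧-mono-⊛ u (relPoly r) (λ y → F (y ++ v)))))))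

⟦⟧-expand-++ : ∀ {n} (ts ts′ : List (Term n)) F →
  ⟦ expand (ts ++ ts′) ⟧ F ≡ ⟦ expand ts ⟧ F + ⟦ expand ts′ ⟧ F
⟦⟧-expand-++ ts ts′ F =
  trans (cong (λ p → ⟦ p ⟧ F) (ListP.concatMap-++ _ ts ts′)) (⟦⟧-++ (expand ts) (expand ts′) F)

Ideal : ∀ {n} → Poly n → Set
Ideal {n} p = Σ (List (Term n)) λ ts → p ≃ expand ts

Ideal-≃ : ∀ {n} {p q : Poly n} → p ≃ q → Ideal p → Ideal q
Ideal-≃ p≃q (ts , p≃ts) = ts , ≃-trans (≃-sym p≃q) p≃ts

Ideal-++ : ∀ {n} {p q : Poly n} → Ideal p → Ideal q → Ideal (p ++ q)
Ideal-++ {p = p} {q} (ts , p≃ts) (ts′ , q≃ts′) = ts ++ ts′ , mk≃ λ F →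
  trans (⟦⟧-≡ (⊕-cong p≃ts q≃ts′) F) (trans (⟦⟧-++ (expand ts) (expand ts′) F) (sym (⟦⟧-expand-++ ts ts′ F)))

scaleTerm : ∀ {n} → ℚ → Term n → Term n
scaleTerm c (q , u , r , v) = (c * q , u , r , v)

⟦⟧-expand-scale : ∀ {n} c (ts : List (Term n)) F → ⟦ expand (map (scaleTerm c) ts) ⟧ F ≡ c * ⟦ expand ts ⟧ F
⟦⟧-expand-scale c []                    F = sym (ℚP.*-zeroʳ c)
⟦⟧-expand-scale c ((q , u , r , v) ∷ ts) F = begin
  ⟦ expand (map (scaleTerm c) ((q , u , r , v) ∷ ts)) ⟧ F
    ≡⟨ ⟦⟧-expand-∷ (c * q) u r v (map (scaleTerm c) ts) F ⟩
  c * q * K + ⟦ expand (map (scaleTerm c) ts) ⟧ F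
    ≡⟨ cong (c * q * K +_) (⟦⟧-expand-scale c ts F) ⟩
  c * q * K + c * ⟦ expand ts ⟧ F
    ≡⟨ solve 4 (λ c q k l → c :* q :* k :+ c :* l := c :* (q :* k :+ l)) refl c q K _ ⟩
  c * (q * K + ⟦ expand ts ⟧ F)
    ≡⟨ cong (c *_) (⟦⟧-expand-∷ q u r v ts F) ⟨
  c * ⟦ expand ((q , u , r , v) ∷ ts) ⟧ F
    ∎
  where
  open ≡-Reasoning
  K = ⟦ relPoly r ⟧ (λ x → F ((u ++ x) ++ v))

Ideal-· : ∀ {n} {p : Poly n} c → Ideal p → Ideal (c · p)
Ideal-· {p = p} c (ts , p≃ts) = map (scaleTerm c) ts , mk≃ λ F →
  trans (⟦⟧-≡ (·-cong c p≃ts) F) (trans (⟦⟧-· c (expand ts) F) (sym (⟦⟧-expand-scale c ts F)))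

module _ {n : ℕ} (s : Poly n) where

  termsʳ : List (Term n) → List (Term n)
  termsʳ = concatMap λ { (q , u , r , v) → map (λ { (b , w) → (q * b , u , r , v ++ w) }) s }

  termsˡ : List (Term n) → List (Term n)
  termsˡ = concatMap λ { (q , u , r , v) → map (λ { (b , w) → (b * q , w ++ u , r , v) }) s }

  ⟦⟧-expand-termsʳ : ∀ ts F → ⟦ expand (termsʳ ts) ⟧ F ≡ ⟦ expand ts ⟧ (λ y → ⟦ s ⟧ (λ w → F (y ++ w)))
  ⟦⟧-expand-termsʳ []                     F = refl
  ⟦⟧-expand-termsʳ ((q , u , r , v) ∷ ts) F = begin
    ⟦ expand (map h s ++ termsʳ ts) ⟧ F
      ≡⟨ ⟦⟧-expand-++ (map h s) (termsʳ ts) F ⟩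
    ⟦ expand (map h s) ⟧ F + ⟦ expand (termsʳ ts) ⟧ F
      ≡⟨ cong₂ _+_ (row s) (⟦⟧-expand-termsʳ ts F) ⟩
    q * ⟦ s ⟧ (λ w → ⟦ relPoly r ⟧ (λ x → F ((u ++ x) ++ (v ++ w)))) + ⟦ expand ts ⟧ G
      ≡⟨ cong (λ z → q * z + ⟦ expand ts ⟧ G) (begin
           ⟦ s ⟧ (λ w → ⟦ relPoly r ⟧ (λ x → F ((u ++ x) ++ (v ++ w))))
             ≡⟨ ⟦⟧-swap s (relPoly r) (λ w x → F ((u ++ x) ++ (v ++ w))) ⟩
           ⟦ relPoly r ⟧ (λ x → ⟦ s ⟧ (λ w → F ((u ++ x) ++ (v ++ w))))
             ≡⟨ ⟦⟧-cong (relPoly r) (λ x → ⟦⟧-cong s (λ w → cong F (sym (ListP.++-assoc (u ++ x) v w)))) ⟩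
           ⟦ relPoly r ⟧ (λ x → G ((u ++ x) ++ v))
             ∎) ⟩
    q * ⟦ relPoly r ⟧ (λ x → G ((u ++ x) ++ v)) + ⟦ expand ts ⟧ G
      ≡⟨ ⟦⟧-expand-∷ q u r v ts G ⟨
    ⟦ expand ((q , u , r , v) ∷ ts) ⟧ G
      ∎
    where
    open ≡-Reasoning
    h = λ { (b , w) → (q * b , u , r , v ++ w) }
    G = λ y → ⟦ s ⟧ (λ w → F (y ++ w))
    row : ∀ s′ → ⟦ expand (map h s′) ⟧ F ≡ q * ⟦ s′ ⟧ (λ w → ⟦ relPoly r ⟧ (λ x → F ((u ++ x) ++ (v ++ w))))
    row []             = sym (ℚP.*-zeroʳ q)
    row ((b , w) ∷ s′) = trans (⟦⟧-expand-∷ (q * b) u r (v ++ w) (map h s′) F)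
      (trans (cong (q * b * _ +_) (row s′))
             (solve 4 (λ q b k l → q :* b :* k :+ q :* l := q :* (b :* k :+ l)) refl q b _ _))

  ⟦⟧-expand-termsˡ : ∀ ts F → ⟦ expand (termsˡ ts) ⟧ F ≡ ⟦ expand ts ⟧ (λ y → ⟦ s ⟧ (λ w → F (w ++ y)))
  ⟦⟧-expand-termsˡ []                     F = refl
  ⟦⟧-expand-termsˡ ((q , u , r , v) ∷ ts) F = begin
    ⟦ expand (map h s ++ termsˡ ts) ⟧ F
      ≡⟨ ⟦⟧-expand-++ (map h s) (termsˡ ts) F ⟩
    ⟦ expand (map h s) ⟧ F + ⟦ expand (termsˡ ts) ⟧ F
      ≡⟨ cong₂ _+_ (row s) (⟦⟧-expand-termsˡ ts F) ⟩
    q * ⟦ s ⟧ (λ w → ⟦ relPoly r ⟧ (λ x → F (((w ++ u) ++ x) ++ v))) + ⟦ expand ts ⟧ G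
      ≡⟨ cong (λ z → q * z + ⟦ expand ts ⟧ G) (begin
           ⟦ s ⟧ (λ w → ⟦ relPoly r ⟧ (λ x → F (((w ++ u) ++ x) ++ v)))
             ≡⟨ ⟦⟧-swap s (relPoly r) (λ w x → F (((w ++ u) ++ x) ++ v)) ⟩
           ⟦ relPoly r ⟧ (λ x → ⟦ s ⟧ (λ w → F (((w ++ u) ++ x) ++ v)))
             ≡⟨ ⟦⟧-cong (relPoly r) (λ x → ⟦⟧-cong s (λ w → cong F (reassoc w x))) ⟩
           ⟦ relPoly r ⟧ (λ x → G ((u ++ x) ++ v))
             ∎) ⟩
    q * ⟦ relPoly r ⟧ (λ x → G ((u ++ x) ++ v)) + ⟦ expand ts ⟧ G
      ≡⟨ ⟦⟧-expand-∷ q u r v ts G ⟨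
    ⟦ expand ((q , u , r , v) ∷ ts) ⟧ G
      ∎
    where
    open ≡-Reasoning
    h = λ { (b , w) → (b * q , w ++ u , r , v) }
    G = λ y → ⟦ s ⟧ (λ w → F (w ++ y))
    reassoc : ∀ w x → ((w ++ u) ++ x) ++ v ≡ w ++ ((u ++ x) ++ v)
    reassoc w x = trans (ListP.++-assoc (w ++ u) x v)
                 (trans (ListP.++-assoc w u (x ++ v)) (cong (w ++_) (sym (ListP.++-assoc u x v))))
    row : ∀ s′ → ⟦ expand (map h s′) ⟧ F ≡ q * ⟦ s′ ⟧ (λ w → ⟦ relPoly r ⟧ (λ x → F (((w ++ u) ++ x) ++ v)))
    row []             = sym (ℚP.*-zeroʳ q)
    row ((b , w) ∷ s′) = trans (⟦⟧-expand-∷ (b * q) (w ++ u) r v (map h s′) F)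
      (trans (cong (b * q * _ +_) (row s′))
             (solve 4 (λ q b k l → b :* q :* k :+ q :* l := q :* (b :* k :+ l)) refl q b _ _))

Ideal-⊛ʳ : ∀ {n} {p : Poly n} s → Ideal p → Ideal (p ⊛ s)
Ideal-⊛ʳ {p = p} s (ts , p≃ts) = termsʳ s ts , mk≃ λ F →
  trans (⟦⟧-≡ (⊛-cong p≃ts (≃-refl {p = s})) F)
        (trans (⟦⟧-⊛ (expand ts) s F) (sym (⟦⟧-expand-termsʳ s ts F)))

Ideal-⊛ˡ : ∀ {n} {p : Poly n} s → Ideal p → Ideal (s ⊛ p)
Ideal-⊛ˡ {p = p} s (ts , p≃ts) = termsˡ s ts , mk≃ λ F →
  trans (⟦⟧-≡ (⊛-cong (≃-refl {p = s}) p≃ts) F)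
        (trans (⟦⟧-⊛ s (expand ts) F)
        (trans (⟦⟧-swap s (expand ts) (λ w y → F (w ++ y))) (sym (⟦⟧-expand-termsˡ s ts F))))

infix 4 _≋_
record _≋_ {n : ℕ} (p q : Poly n) : Set where
  constructor mk≋
  field difference : Ideal (p ⊖ q)

≋⇒≈OS : ∀ {n} {p q : Poly n} → p ≋ q → p ≈OS q
≋⇒≈OS {p = p} {q} (mk≋ (ts , p-q≃ts)) = ts , λ w →
  trans (coeff-⟦⟧ (p ⊖ q) w) (trans (⟦⟧-≡ p-q≃ts (δ w)) (sym (coeff-⟦⟧ (expand ts) w)))
  where
  δ : Word _ → Word _ → ℚ
  δ w u = if eqW u w then 1ℚ else 0ℚ
  coeff-⟦⟧ : ∀ p w → coeff p w ≡ ⟦ p ⟧ (δ w)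
  coeff-⟦⟧ []            w = refl
  coeff-⟦⟧ ((q , u) ∷ p) w with eqW u w
  ... | true  = cong₂ _+_ (sym (ℚP.*-identityʳ q)) (coeff-⟦⟧ p w)
  ... | false = trans (coeff-⟦⟧ p w) (sym (trans (cong (_+ ⟦ p ⟧ (δ w)) (ℚP.*-zeroʳ q)) (ℚP.+-identityˡ _)))

≃⇒≋ : ∀ {n} {p q : Poly n} → p ≃ q → p ≋ q
≃⇒≋ {p = p} {q} p≃q = mk≋ ([] , mk≃ λ F → begin
  ⟦ p ⊖ q ⟧ F                    ≡⟨ ⟦⟧-⊖ p q F ⟩
  ⟦ p ⟧ F + (- 1ℚ) * ⟦ q ⟧ F      ≡⟨ cong (λ z → ⟦ p ⟧ F + (- 1ℚ) * z) (⟦⟧-≡ p≃q F) ⟨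
  ⟦ p ⟧ F + (- 1ℚ) * ⟦ p ⟧ F      ≡⟨ solve 1 (λ x → x :+ con (- 1ℚ) :* x := con 0ℚ) refl (⟦ p ⟧ F) ⟩
  0ℚ                              ∎)
  where open ≡-Reasoning

Ideal⇒≋[] : ∀ {n} {p : Poly n} → Ideal p → p ≋ []
Ideal⇒≋[] {p = p} = mk≋ ∘ Ideal-≃ (mk≃ λ F → sym (trans (⟦⟧-⊖ p [] F)
  (trans (cong (⟦ p ⟧ F +_) (ℚP.*-zeroʳ (- 1ℚ))) (ℚP.+-identityʳ (⟦ p ⟧ F)))))

module _ {n : ℕ} where

  private
    ≋-via : ∀ {p q p′ q′ : Poly n} (f : Poly n → Poly n) →
      (∀ {r} → Ideal r → Ideal (f r)) → f (p ⊖ q) ≃ p′ ⊖ q′ → p ≋ q → p′ ≋ q′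
    ≋-via f closed eq (mk≋ i) = mk≋ (Ideal-≃ eq (closed i))

  ≋-refl : ∀ {p : Poly n} → p ≋ p
  ≋-refl = ≃⇒≋ ≃-refl

  ≋-sym : ∀ {p q : Poly n} → p ≋ q → q ≋ p
  ≋-sym {p} {q} = ≋-via ((- 1ℚ) ·_) (Ideal-· (- 1ℚ)) (mk≃ λ F → begin
    ⟦ (- 1ℚ) · (p ⊖ q) ⟧ F
      ≡⟨ ⟦⟧-· (- 1ℚ) (p ⊖ q) F ⟩
    (- 1ℚ) * ⟦ p ⊖ q ⟧ F
      ≡⟨ cong ((- 1ℚ) *_) (⟦⟧-⊖ p q F) ⟩
    (- 1ℚ) * (⟦ p ⟧ F + (- 1ℚ) * ⟦ q ⟧ F)
      ≡⟨ solve 2 (λ x y → con (- 1ℚ) :* (x :+ con (- 1ℚ) :* y) := y :+ con (- 1ℚ) :* x) refl (⟦ p ⟧ F) (⟦ q ⟧ F) ⟩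
    ⟦ q ⟧ F + (- 1ℚ) * ⟦ p ⟧ F
      ≡⟨ ⟦⟧-⊖ q p F ⟨
    ⟦ q ⊖ p ⟧ F
      ∎)
    where open ≡-Reasoning

  ≋-⊕ : ∀ {p p′ q q′ : Poly n} → p ≋ p′ → q ≋ q′ → p ⊕ q ≋ p′ ⊕ q′
  ≋-⊕ {p} {p′} {q} {q′} (mk≋ i) (mk≋ j) = mk≋ (Ideal-≃ (mk≃ λ F → begin
    ⟦ (p ⊖ p′) ++ (q ⊖ q′) ⟧ F
      ≡⟨ trans (⟦⟧-++ (p ⊖ p′) (q ⊖ q′) F) (cong₂ _+_ (⟦⟧-⊖ p p′ F) (⟦⟧-⊖ q q′ F)) ⟩
    (⟦ p ⟧ F + (- 1ℚ) * ⟦ p′ ⟧ F) + (⟦ q ⟧ F + (- 1ℚ) * ⟦ q′ ⟧ F)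
      ≡⟨ solve 4 (λ x y z w → (x :+ con (- 1ℚ) :* y) :+ (z :+ con (- 1ℚ) :* w)
                            := (x :+ z) :+ con (- 1ℚ) :* (y :+ w)) refl (⟦ p ⟧ F) (⟦ p′ ⟧ F) (⟦ q ⟧ F) (⟦ q′ ⟧ F) ⟩
    (⟦ p ⟧ F + ⟦ q ⟧ F) + (- 1ℚ) * (⟦ p′ ⟧ F + ⟦ q′ ⟧ F)
      ≡⟨ trans (⟦⟧-⊖ (p ⊕ q) (p′ ⊕ q′) F) (cong₂ (λ x y → x + (- 1ℚ) * y) (⟦⟧-++ p q F) (⟦⟧-++ p′ q′ F)) ⟨
    ⟦ (p ⊕ q) ⊖ (p′ ⊕ q′) ⟧ F
      ∎) (Ideal-++ i j))
    where open ≡-Reasoning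

  ≋-trans : ∀ {p q r : Poly n} → p ≋ q → q ≋ r → p ≋ r
  ≋-trans {p} {q} {r} (mk≋ i) (mk≋ j) = mk≋ (Ideal-≃ (mk≃ λ F → begin
    ⟦ (p ⊖ q) ++ (q ⊖ r) ⟧ F
      ≡⟨ trans (⟦⟧-++ (p ⊖ q) (q ⊖ r) F) (cong₂ _+_ (⟦⟧-⊖ p q F) (⟦⟧-⊖ q r F)) ⟩
    (⟦ p ⟧ F + (- 1ℚ) * ⟦ q ⟧ F) + (⟦ q ⟧ F + (- 1ℚ) * ⟦ r ⟧ F)
      ≡⟨ solve 3 (λ x y z → (x :+ con (- 1ℚ) :* y) :+ (y :+ con (- 1ℚ) :* z) := x :+ con (- 1ℚ) :* z) refl (⟦ p ⟧ F) (⟦ q ⟧ F) (⟦ r ⟧ F) ⟩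
    ⟦ p ⟧ F + (- 1ℚ) * ⟦ r ⟧ F
      ≡⟨ ⟦⟧-⊖ p r F ⟨
    ⟦ p ⊖ r ⟧ F
      ∎) (Ideal-++ i j))
    where open ≡-Reasoning

  ≋-· : ∀ c {p q : Poly n} → p ≋ q → c · p ≋ c · q
  ≋-· c {p} {q} = ≋-via (c ·_) (Ideal-· c) (mk≃ λ F → begin
    ⟦ c · (p ⊖ q) ⟧ F
      ≡⟨ trans (⟦⟧-· c (p ⊖ q) F) (cong (c *_) (⟦⟧-⊖ p q F)) ⟩
    c * (⟦ p ⟧ F + (- 1ℚ) * ⟦ q ⟧ F)
      ≡⟨ solve 3 (λ c x y → c :* (x :+ con (- 1ℚ) :* y) := c :* x :+ con (- 1ℚ) :* (c :* y)) refl c (⟦ p ⟧ F) (⟦ q ⟧ F) ⟩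
    c * ⟦ p ⟧ F + (- 1ℚ) * (c * ⟦ q ⟧ F)
      ≡⟨ trans (⟦⟧-⊖ (c · p) (c · q) F) (cong₂ (λ x y → x + (- 1ℚ) * y) (⟦⟧-· c p F) (⟦⟧-· c q F)) ⟨
    ⟦ (c · p) ⊖ (c · q) ⟧ F
      ∎)
    where open ≡-Reasoning

  ≋-⊛ʳ : ∀ s {p q : Poly n} → p ≋ q → p ⊛ s ≋ q ⊛ s
  ≋-⊛ʳ s {p} {q} = ≋-via (_⊛ s) (Ideal-⊛ʳ s) (mk≃ λ F → begin
    ⟦ (p ⊖ q) ⊛ s ⟧ F
      ≡⟨ ⟦⟧-⊛ (p ⊖ q) s F ⟩
    ⟦ p ⊖ q ⟧ (λ u → ⟦ s ⟧ (λ v → F (u ++ v)))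
      ≡⟨ ⟦⟧-⊖ p q _ ⟩
    ⟦ p ⟧ (λ u → ⟦ s ⟧ (λ v → F (u ++ v))) + (- 1ℚ) * ⟦ q ⟧ (λ u → ⟦ s ⟧ (λ v → F (u ++ v)))
      ≡⟨ cong₂ (λ x y → x + (- 1ℚ) * y) (⟦⟧-⊛ p s F) (⟦⟧-⊛ q s F) ⟨
    ⟦ p ⊛ s ⟧ F + (- 1ℚ) * ⟦ q ⊛ s ⟧ F
      ≡⟨ ⟦⟧-⊖ (p ⊛ s) (q ⊛ s) F ⟨
    ⟦ (p ⊛ s) ⊖ (q ⊛ s) ⟧ F
      ∎)
    where open ≡-Reasoning

  ≋-⊛ˡ : ∀ s {p q : Poly n} → p ≋ q → s ⊛ p ≋ s ⊛ q
  ≋-⊛ˡ s {p} {q} = ≋-via (s ⊛_) (Ideal-⊛ˡ s) (mk≃ λ F → begin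
    ⟦ s ⊛ (p ⊖ q) ⟧ F
      ≡⟨ ⟦⟧-⊛ s (p ⊖ q) F ⟩
    ⟦ s ⟧ (λ u → ⟦ p ⊖ q ⟧ (λ v → F (u ++ v)))
      ≡⟨ ⟦⟧-cong s (λ u → ⟦⟧-⊖ p q _) ⟩
    ⟦ s ⟧ (λ u → ⟦ p ⟧ (λ v → F (u ++ v)) + (- 1ℚ) * ⟦ q ⟧ (λ v → F (u ++ v)))
      ≡⟨ ⟦⟧-+ᶠ s _ _ ⟩
    ⟦ s ⟧ (λ u → ⟦ p ⟧ (λ v → F (u ++ v))) + ⟦ s ⟧ (λ u → (- 1ℚ) * ⟦ q ⟧ (λ v → F (u ++ v)))
      ≡⟨ cong₂ _+_ (sym (⟦⟧-⊛ s p F)) (trans (⟦⟧-*ᶠ s (- 1ℚ) _) (cong ((- 1ℚ) *_) (sym (⟦⟧-⊛ s q F)))) ⟩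
    ⟦ s ⊛ p ⟧ F + (- 1ℚ) * ⟦ s ⊛ q ⟧ F
      ≡⟨ ⟦⟧-⊖ (s ⊛ p) (s ⊛ q) F ⟨
    ⟦ (s ⊛ p) ⊖ (s ⊛ q) ⟧ F
      ∎)
    where open ≡-Reasoning

≋-setoid : ℕ → Setoid _ _
≋-setoid n = record
  { Carrier       = Poly n
  ; _≈_           = _≋_
  ; isEquivalence = record { refl = ≋-refl ; sym = ≋-sym ; trans = ≋-trans }
  }

module ≋-Reasoning {n : ℕ} = SetoidReasoning (≋-setoid n)

-- Grading and the Leibniz rule

Homogeneous : ∀ {n} → ℕ → Poly n → Set
Homogeneous k = All (λ t → length (proj₂ t) ≡ k)

⟦⟧-cong-homogeneous : ∀ {n k} (p : Poly n) {F G : Word n → ℚ} → Homogeneous k p →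
  (∀ u → length u ≡ k → F u ≡ G u) → ⟦ p ⟧ F ≡ ⟦ p ⟧ G
⟦⟧-cong-homogeneous []            []       eq = refl
⟦⟧-cong-homogeneous ((a , u) ∷ p) (hu ∷ h) eq =
  cong₂ (λ x y → a * x + y) (eq u hu) (⟦⟧-cong-homogeneous p h eq)

homogeneous-concatMap-tabulate : ∀ {n k N} {A : Set} (g : A → Poly n) (t : Fin N → A) →
  (∀ i → Homogeneous k (g (t i))) → Homogeneous k (concatMap g (tabulate t))
homogeneous-concatMap-tabulate g t h = AllP.concat⁺ (AllP.map⁺ (AllP.tabulate⁺ h))

homogeneous-· : ∀ {n k} r {p : Poly n} → Homogeneous k p → Homogeneous k (r · p)
homogeneous-· r = AllP.gmap⁺ λ { {_ , _} h → h }

homogeneous-⊛ : ∀ {n k l} {p q : Poly n} → Homogeneous k p → Homogeneous l q →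
  Homogeneous (k ℕ.+ l) (p ⊛ q)
homogeneous-⊛ hp hq = AllP.concat⁺ (AllP.gmap⁺ (λ { {_ , u} hu →
  AllP.gmap⁺ (λ { {_ , v} hv → trans (ListP.length-++ u) (cong₂ ℕ._+_ hu hv) }) hq }) hp)

homogeneous-∂̂ : ∀ {n k} {p : Poly n} → Homogeneous (suc k) p → Homogeneous k (∂̂ p)
homogeneous-∂̂ = AllP.concat⁺ ∘ AllP.gmap⁺ λ { {q , w} hw → homogeneous-· q (∂w-homogeneous w hw) }
  where
  ∂w-homogeneous : ∀ {n k} (w : Word n) → length w ≡ suc k → Homogeneous k (∂w w)
  ∂w-homogeneous w hw = AllP.map⁺ (AllP.tabulate⁺ λ i → trans (ListP.length-removeAt w i) (cong ℕ.pred hw))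

-1*q≡-q : ∀ q → (- 1ℚ) * q ≡ - q
-1*q≡-q q = trans (sym (ℚP.neg-distribˡ-* 1ℚ q)) (cong -_ (ℚP.*-identityˡ q))

∂w-∷ : ∀ {n} (x : Gen n) w → ∂w (x ∷ w) ≡ (1ℚ , w) ∷ map (λ { (b , v) → (- b , x ∷ v) }) (∂w w)
∂w-∷ x w = cong ((1ℚ , w) ∷_) (trans (ListP.map-tabulate Fin.suc _)
  (sym (trans (cong (map _) (ListP.map-tabulate id _)) (ListP.map-tabulate _ _))))

⟦⟧-∂w-∷ : ∀ {n} (x : Gen n) w F → ⟦ ∂w (x ∷ w) ⟧ F ≡ F w + (- 1ℚ) * ⟦ ∂w w ⟧ (λ y → F (x ∷ y))
⟦⟧-∂w-∷ x w F = trans (cong (λ p → ⟦ p ⟧ F) (∂w-∷ x w)) (cong₂ _+_ (ℚP.*-identityˡ (F w))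
  (⟦⟧-map _ (- 1ℚ) (x ∷_) (λ b v → cong (_, x ∷ v) (sym (-1*q≡-q b))) (∂w w) F))

⟦⟧-∂w-++ : ∀ {n} (u v : Word n) F →
  ⟦ ∂w (u ++ v) ⟧ F ≡ ⟦ ∂w u ⟧ (λ x → F (x ++ v)) + sgn (length u) * ⟦ ∂w v ⟧ (λ y → F (u ++ y))
⟦⟧-∂w-++ []      v F = sym (trans (ℚP.+-identityˡ _) (ℚP.*-identityˡ _))
⟦⟧-∂w-++ (x ∷ u) v F = begin
  ⟦ ∂w (x ∷ (u ++ v)) ⟧ F
    ≡⟨ ⟦⟧-∂w-∷ x (u ++ v) F ⟩
  F (u ++ v) + (- 1ℚ) * ⟦ ∂w (u ++ v) ⟧ (λ y → F (x ∷ y))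
    ≡⟨ cong (λ z → F (u ++ v) + (- 1ℚ) * z) (⟦⟧-∂w-++ u v (λ y → F (x ∷ y))) ⟩
  F (u ++ v) + (- 1ℚ) * (A + s * B)
    ≡⟨ solve 4 (λ a b s c → a :+ con (- 1ℚ) :* (b :+ s :* c) := (a :+ con (- 1ℚ) :* b) :+ (con (- 1ℚ) :* s) :* c)
               refl (F (u ++ v)) A s B ⟩
  (F (u ++ v) + (- 1ℚ) * A) + ((- 1ℚ) * s) * B
    ≡⟨ cong₂ (λ x y → x + y * B) (⟦⟧-∂w-∷ x u (λ z → F (z ++ v))) (sym (-1*q≡-q s)) ⟨
  ⟦ ∂w (x ∷ u) ⟧ (λ z → F (z ++ v)) + (- s) * B
    ∎
  where
  open ≡-Reasoning
  A = ⟦ ∂w u ⟧ (λ z → F (x ∷ (z ++ v)))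
  B = ⟦ ∂w v ⟧ (λ y → F (x ∷ (u ++ y)))
  s = sgn (length u)

∂̂-⊛ : ∀ {n k} (p q : Poly n) → Homogeneous k p → ∂̂ (p ⊛ q) ≃ (∂̂ p ⊛ q) ⊕ (sgn k · (p ⊛ ∂̂ q))
∂̂-⊛ {k = k} p q hp = mk≃ leibniz
  where
  leibniz : ∀ F → ⟦ ∂̂ (p ⊛ q) ⟧ F ≡ ⟦ (∂̂ p ⊛ q) ⊕ (sgn k · (p ⊛ ∂̂ q)) ⟧ F
  leibniz F = begin
    ⟦ ∂̂ (p ⊛ q) ⟧ F
      ≡⟨ trans (⟦⟧-∂̂ (p ⊛ q) F) (⟦⟧-⊛ p q _) ⟩
    ⟦ p ⟧ (λ u → ⟦ q ⟧ (λ v → ⟦ ∂w (u ++ v) ⟧ F))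
      ≡⟨ ⟦⟧-cong-homogeneous p hp (λ u hu → ⟦⟧-cong q (λ v →
           trans (⟦⟧-∂w-++ u v F) (cong (λ l → A u v + sgn l * B u v) hu))) ⟩
    ⟦ p ⟧ (λ u → ⟦ q ⟧ (λ v → A u v + sgn k * B u v))
      ≡⟨ ⟦⟧-cong p (λ u → trans (⟦⟧-+ᶠ q (A u) _) (cong (⟦ q ⟧ (A u) +_) (⟦⟧-*ᶠ q (sgn k) (B u)))) ⟩
    ⟦ p ⟧ (λ u → ⟦ q ⟧ (A u) + sgn k * ⟦ q ⟧ (B u))
      ≡⟨ trans (⟦⟧-+ᶠ p _ _) (cong (⟦ p ⟧ (λ u → ⟦ q ⟧ (A u)) +_) (⟦⟧-*ᶠ p (sgn k) _)) ⟩
    ⟦ p ⟧ (λ u → ⟦ q ⟧ (A u)) + sgn k * ⟦ p ⟧ (λ u → ⟦ q ⟧ (B u))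
      ≡⟨ cong₂ (λ x y → x + sgn k * y) ∂̂p⊛q p⊛∂̂q ⟨
    ⟦ ∂̂ p ⊛ q ⟧ F + sgn k * ⟦ p ⊛ ∂̂ q ⟧ F
      ≡⟨ trans (⟦⟧-++ (∂̂ p ⊛ q) _ F) (cong (⟦ ∂̂ p ⊛ q ⟧ F +_) (⟦⟧-· (sgn k) (p ⊛ ∂̂ q) F)) ⟨
    ⟦ (∂̂ p ⊛ q) ⊕ (sgn k · (p ⊛ ∂̂ q)) ⟧ F
      ∎
    where
    open ≡-Reasoning
    A = λ u v → ⟦ ∂w u ⟧ (λ x → F (x ++ v))
    B = λ u v → ⟦ ∂w v ⟧ (λ y → F (u ++ y))
    ∂̂p⊛q : ⟦ ∂̂ p ⊛ q ⟧ F ≡ ⟦ p ⟧ (λ u → ⟦ q ⟧ (A u))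
    ∂̂p⊛q = trans (⟦⟧-⊛ (∂̂ p) q F)
             (trans (⟦⟧-∂̂ p _) (⟦⟧-cong p (λ u → ⟦⟧-swap (∂w u) q (λ x v → F (x ++ v)))))
    p⊛∂̂q : ⟦ p ⊛ ∂̂ q ⟧ F ≡ ⟦ p ⟧ (λ u → ⟦ q ⟧ (B u))
    p⊛∂̂q = trans (⟦⟧-⊛ p (∂̂ q) F) (⟦⟧-cong p (λ u → ⟦⟧-∂̂ q (λ y → F (u ++ y))))

pairTerms : ∀ {n} → Poly n → Poly n → (Word n → Word n → List (Term n)) → List (Term n)
pairTerms p q W = concatMap (λ { (a , u) → concatMap (λ { (b , x) → map (scaleTerm (a * b)) (W u x) }) q }) p

⟦⟧-expand-pairTerms : ∀ {n} (p q : Poly n) W F →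
  ⟦ expand (pairTerms p q W) ⟧ F ≡ ⟦ p ⟧ (λ u → ⟦ q ⟧ (λ x → ⟦ expand (W u x) ⟧ F))
⟦⟧-expand-pairTerms []            q W F = refl
⟦⟧-expand-pairTerms ((a , u) ∷ p) q W F =
  trans (⟦⟧-expand-++ (concatMap _ q) (pairTerms p q W) F) (cong₂ _+_ (row q) (⟦⟧-expand-pairTerms p q W F))
  where
  row : ∀ q → ⟦ expand (concatMap (λ { (b , x) → map (scaleTerm (a * b)) (W u x) }) q) ⟧ F
            ≡ a * ⟦ q ⟧ (λ x → ⟦ expand (W u x) ⟧ F)
  row []            = sym (ℚP.*-zeroʳ a)
  row ((b , x) ∷ q) = trans (⟦⟧-expand-++ (map (scaleTerm (a * b)) (W u x)) _ F)
    (trans (cong₂ _+_ (⟦⟧-expand-scale (a * b) (W u x) F) (row q))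
           (solve 4 (λ a b k r → a :* b :* k :+ a :* r := a :* (b :* k :+ r)) refl a b _ _))

⟦⟧-⊖ᶠ : ∀ {n} (p : Poly n) F G → ⟦ p ⟧ (λ u → F u + (- 1ℚ) * G u) ≡ ⟦ p ⟧ F + (- 1ℚ) * ⟦ p ⟧ G
⟦⟧-⊖ᶠ p F G = trans (⟦⟧-+ᶠ p F _) (cong (⟦ p ⟧ F +_) (⟦⟧-*ᶠ p (- 1ℚ) G))

⊛-comm-deg2-deg1 : ∀ {n} (p q : Poly n) → Homogeneous 2 p → Homogeneous 1 q → p ⊛ q ≋ q ⊛ p
⊛-comm-deg2-deg1 {n} p q hp hq = mk≋ (pairTerms p q W , mk≃ commute)
  where
  -- u₁u₂x − xu₁u₂ = u₁(u₂x + xu₂) − (u₁x + xu₁)u₂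
  W : Word n → Word n → List (Term n)
  W (u₁ ∷ u₂ ∷ []) (x ∷ []) = (1ℚ , u₁ ∷ [] , anti u₂ x , []) ∷ (- 1ℚ , [] , anti u₁ x , u₂ ∷ []) ∷ []
  W _              _        = []

  commutator : ∀ F u → length u ≡ 2 → ∀ x → length x ≡ 1 →
    F (u ++ x) + (- 1ℚ) * F (x ++ u) ≡ ⟦ expand (W u x) ⟧ F
  commutator F (u₁ ∷ u₂ ∷ []) refl (x ∷ []) refl = sym (begin
    ⟦ expand (W (u₁ ∷ u₂ ∷ []) (x ∷ [])) ⟧ F
      ≡⟨ ⟦⟧-expand-∷ 1ℚ (u₁ ∷ []) (anti u₂ x) [] ((- 1ℚ , [] , anti u₁ x , u₂ ∷ []) ∷ []) F ⟩
    1ℚ * (1ℚ * a + (1ℚ * b + 0ℚ)) + ⟦ expand ((- 1ℚ , [] , anti u₁ x , u₂ ∷ []) ∷ []) ⟧ F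
      ≡⟨ cong (1ℚ * (1ℚ * a + (1ℚ * b + 0ℚ)) +_) (⟦⟧-expand-∷ (- 1ℚ) [] (anti u₁ x) (u₂ ∷ []) [] F) ⟩
    1ℚ * (1ℚ * a + (1ℚ * b + 0ℚ)) + ((- 1ℚ) * (1ℚ * b + (1ℚ * c + 0ℚ)) + 0ℚ)
      ≡⟨ solve 3 (λ a b c → con 1ℚ :* (con 1ℚ :* a :+ (con 1ℚ :* b :+ con 0ℚ))
                             :+ (con (- 1ℚ) :* (con 1ℚ :* b :+ (con 1ℚ :* c :+ con 0ℚ)) :+ con 0ℚ)
                           := a :+ con (- 1ℚ) :* c) refl a b c ⟩
    a + (- 1ℚ) * c
      ∎)
    where
    open ≡-Reasoning
    a = F (u₁ ∷ u₂ ∷ x ∷ [])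
    b = F (u₁ ∷ x ∷ u₂ ∷ [])
    c = F (x ∷ u₁ ∷ u₂ ∷ [])

  commute : ∀ F → ⟦ (p ⊛ q) ⊖ (q ⊛ p) ⟧ F ≡ ⟦ expand (pairTerms p q W) ⟧ F
  commute F = begin
    ⟦ (p ⊛ q) ⊖ (q ⊛ p) ⟧ F
      ≡⟨ ⟦⟧-⊖ (p ⊛ q) (q ⊛ p) F ⟩
    ⟦ p ⊛ q ⟧ F + (- 1ℚ) * ⟦ q ⊛ p ⟧ F
      ≡⟨ cong₂ (λ a b → a + (- 1ℚ) * b) (⟦⟧-⊛ p q F)
               (trans (⟦⟧-⊛ q p F) (⟦⟧-swap q p (λ x u → F (x ++ u)))) ⟩
    ⟦ p ⟧ (λ u → ⟦ q ⟧ (λ x → F (u ++ x))) + (- 1ℚ) * ⟦ p ⟧ (λ u → ⟦ q ⟧ (λ x → F (x ++ u)))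
      ≡⟨ ⟦⟧-⊖ᶠ p _ _ ⟨
    ⟦ p ⟧ (λ u → ⟦ q ⟧ (λ x → F (u ++ x)) + (- 1ℚ) * ⟦ q ⟧ (λ x → F (x ++ u)))
      ≡⟨ ⟦⟧-cong p (λ u → ⟦⟧-⊖ᶠ q _ _) ⟨
    ⟦ p ⟧ (λ u → ⟦ q ⟧ (λ x → F (u ++ x) + (- 1ℚ) * F (x ++ u)))
      ≡⟨ ⟦⟧-cong-homogeneous p hp (λ u hu → ⟦⟧-cong-homogeneous q hq (commutator F u hu)) ⟩
    ⟦ p ⟧ (λ u → ⟦ q ⟧ (λ x → ⟦ expand (W u x) ⟧ F))
      ≡⟨ ⟦⟧-expand-pairTerms p q W F ⟨
    ⟦ expand (pairTerms p q W) ⟧ F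
      ∎
    where open ≡-Reasoning

square-deg1≋[] : ∀ {n} (q : Poly n) → Homogeneous 1 q → q ⊛ q ≋ []
square-deg1≋[] {n} q hq = Ideal⇒≋[] (pairTerms q q W , mk≃ symmetrise)
  where
  -- q q = ½ Σ (ux + xu) over pairs of monomials u, x of q
  W : Word n → Word n → List (Term n)
  W (u ∷ []) (x ∷ []) = (½ , [] , anti u x , []) ∷ []
  W _        _        = []

  half-anticommutator : ∀ F u → length u ≡ 1 → ∀ x → length x ≡ 1 →
    ½ * (F (u ++ x) + F (x ++ u)) ≡ ⟦ expand (W u x) ⟧ F
  half-anticommutator F (u ∷ []) refl (x ∷ []) refl = sym (trans (⟦⟧-expand-∷ ½ [] (anti u x) [] [] F)
    (solve 2 (λ a b → con ½ :* (con 1ℚ :* a :+ (con 1ℚ :* b :+ con 0ℚ)) :+ con 0ℚ := con ½ :* (a :+ b))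
             refl (F (u ∷ x ∷ [])) (F (x ∷ u ∷ []))))

  symmetrise : ∀ F → ⟦ q ⊛ q ⟧ F ≡ ⟦ expand (pairTerms q q W) ⟧ F
  symmetrise F = begin
    ⟦ q ⊛ q ⟧ F
      ≡⟨ ⟦⟧-⊛ q q F ⟩
    S
      ≡⟨ solve 1 (λ s → s := con ½ :* (s :+ s)) refl S ⟩
    ½ * (S + S)
      ≡⟨ cong (λ z → ½ * (S + z)) (⟦⟧-swap q q (λ u x → F (u ++ x))) ⟩
    ½ * (S + ⟦ q ⟧ (λ u → ⟦ q ⟧ (λ x → F (x ++ u))))
      ≡⟨ cong (½ *_) (⟦⟧-+ᶠ q (λ u → ⟦ q ⟧ (λ x → F (u ++ x))) (λ u → ⟦ q ⟧ (λ x → F (x ++ u)))) ⟨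
    ½ * ⟦ q ⟧ (λ u → ⟦ q ⟧ (λ x → F (u ++ x)) + ⟦ q ⟧ (λ x → F (x ++ u)))
      ≡⟨ ⟦⟧-*ᶠ q ½ (λ u → ⟦ q ⟧ (λ x → F (u ++ x)) + ⟦ q ⟧ (λ x → F (x ++ u))) ⟨
    ⟦ q ⟧ (λ u → ½ * (⟦ q ⟧ (λ x → F (u ++ x)) + ⟦ q ⟧ (λ x → F (x ++ u))))
      ≡⟨ ⟦⟧-cong q (λ u → trans (⟦⟧-*ᶠ q ½ (λ x → F (u ++ x) + F (x ++ u)))
                                (cong (½ *_) (⟦⟧-+ᶠ q (λ x → F (u ++ x)) (λ x → F (x ++ u))))) ⟨
    ⟦ q ⟧ (λ u → ⟦ q ⟧ (λ x → ½ * (F (u ++ x) + F (x ++ u))))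
      ≡⟨ ⟦⟧-cong-homogeneous q hq (λ u hu → ⟦⟧-cong-homogeneous q hq (half-anticommutator F u hu)) ⟩
    ⟦ q ⟧ (λ u → ⟦ q ⟧ (λ x → ⟦ expand (W u x) ⟧ F))
      ≡⟨ ⟦⟧-expand-pairTerms q q W F ⟨
    ⟦ expand (pairTerms q q W) ⟧ F
      ∎
    where
    open ≡-Reasoning
    S = ⟦ q ⟧ (λ u → ⟦ q ⟧ (λ x → F (u ++ x)))

coeffSum : ∀ {n} → Poly n → ℚ
coeffSum p = ⟦ p ⟧ (λ _ → 1ℚ)

∂̂-deg1 : ∀ {n} (p : Poly n) → Homogeneous 1 p → ∂̂ p ≃ const (coeffSum p)
∂̂-deg1 p hp = mk≃ λ F → begin
  ⟦ ∂̂ p ⟧ F                        ≡⟨ ⟦⟧-∂̂ p F ⟩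
  ⟦ p ⟧ (λ u → ⟦ ∂w u ⟧ F)          ≡⟨ ⟦⟧-cong-homogeneous p hp ∂w-letter ⟩
  ⟦ p ⟧ (λ _ → F [] * 1ℚ)           ≡⟨ ⟦⟧-*ᶠ p (F []) (λ _ → 1ℚ) ⟩
  F [] * coeffSum p                 ≡⟨ ℚP.*-comm (F []) (coeffSum p) ⟩
  coeffSum p * F []                 ≡⟨ ⟦⟧-const (coeffSum p) F ⟨
  ⟦ const (coeffSum p) ⟧ F          ∎
  where
  open ≡-Reasoning
  ∂w-letter : ∀ {F} u → length u ≡ 1 → ⟦ ∂w u ⟧ F ≡ F [] * 1ℚ
  ∂w-letter {F} (x ∷ []) refl =
    trans (ℚP.+-identityʳ _) (trans (ℚP.*-identityˡ (F [])) (sym (ℚP.*-identityʳ (F []))))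

∂̂-deg1-⊛ : ∀ {n} (x y : Poly n) → Homogeneous 1 x → Homogeneous 1 y →
  ∂̂ (x ⊛ y) ≃ ((- coeffSum y) · x) ⊕ (coeffSum x · y)
∂̂-deg1-⊛ x y hx hy = ≃-trans (∂̂-⊛ x y hx) (mk≃ λ F → begin
  ⟦ (∂̂ x ⊛ y) ⊕ ((- 1ℚ) · (x ⊛ ∂̂ y)) ⟧ F
    ≡⟨ ⟦⟧-++ (∂̂ x ⊛ y) ((- 1ℚ) · (x ⊛ ∂̂ y)) F ⟩
  ⟦ ∂̂ x ⊛ y ⟧ F + ⟦ (- 1ℚ) · (x ⊛ ∂̂ y) ⟧ F
    ≡⟨ cong₂ _+_ (⟦⟧-≡ ∂̂x⊛y F) (⟦⟧-≡ (·-cong (- 1ℚ) x⊛∂̂y) F) ⟩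
  ⟦ coeffSum x · y ⟧ F + ⟦ (- 1ℚ) · (coeffSum y · x) ⟧ F
    ≡⟨ cong₂ _+_ (⟦⟧-· (coeffSum x) y F)
                 (trans (⟦⟧-· (- 1ℚ) (coeffSum y · x) F) (cong ((- 1ℚ) *_) (⟦⟧-· (coeffSum y) x F))) ⟩
  coeffSum x * ⟦ y ⟧ F + (- 1ℚ) * (coeffSum y * ⟦ x ⟧ F)
    ≡⟨ solve 4 (λ a b X Y → a :* Y :+ con (- 1ℚ) :* (b :* X) := (:- b) :* X :+ a :* Y) refl
               (coeffSum x) (coeffSum y) (⟦ x ⟧ F) (⟦ y ⟧ F) ⟩
  (- coeffSum y) * ⟦ x ⟧ F + coeffSum x * ⟦ y ⟧ F
    ≡⟨ ⟦⟧-lincomb (- coeffSum y) (coeffSum x) x y F ⟨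
  ⟦ ((- coeffSum y) · x) ⊕ (coeffSum x · y) ⟧ F
    ∎)
  where
  open ≡-Reasoning
  ∂̂x⊛y : ∂̂ x ⊛ y ≃ coeffSum x · y
  ∂̂x⊛y = ≃-trans (⊛-cong (∂̂-deg1 x hx) (≃-refl {p = y})) (const-⊛ (coeffSum x) y)
  x⊛∂̂y : x ⊛ ∂̂ y ≃ coeffSum y · x
  x⊛∂̂y = ≃-trans (⊛-cong (≃-refl {p = x}) (∂̂-deg1 y hy)) (⊛-const x (coeffSum y))

-- The Leibniz sign sgn 2 computes to 1ℚ.
∂̂-^ : ∀ {n} (c : Poly n) → Homogeneous 2 c → ∀ d → ∂̂ (c ^ suc d) ≋ ℕ→ℚ (suc d) · (∂̂ c ⊛ (c ^ d))
∂̂-^ c hc zero = ≃⇒≋ (≃-trans (∂̂-⊛ c (const 1ℚ) hc)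
  (≃-trans (⊕-cong ≃-refl (≃-trans (·-identityˡ (c ⊛ [])) (⊛-[] c)))
           (≃-trans (⊕-identityʳ _) (≃-sym (·-identityˡ _)))))
∂̂-^ c hc (suc d) = begin
  ∂̂ (c ⊛ (c ^ suc d))
    ≈⟨ ≃⇒≋ (∂̂-⊛ c (c ^ suc d) hc) ⟩
  (∂̂ c ⊛ (c ^ suc d)) ⊕ (1ℚ · (c ⊛ ∂̂ (c ^ suc d)))
    ≈⟨ ≋-⊕ ≋-refl (≋-· 1ℚ (≋-⊛ˡ c (∂̂-^ c hc d))) ⟩
  (∂̂ c ⊛ (c ^ suc d)) ⊕ (1ℚ · (c ⊛ (k · (∂̂ c ⊛ (c ^ d)))))
    ≈⟨ ≃⇒≋ (⊕-cong ≃-refl (≃-trans (·-identityˡ _) (⊛-·ʳ c k _))) ⟩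
  (∂̂ c ⊛ (c ^ suc d)) ⊕ (k · (c ⊛ (∂̂ c ⊛ (c ^ d))))
    ≈⟨ ≃⇒≋ (⊕-cong ≃-refl (·-cong k (≃-sym (⊛-assoc c (∂̂ c) (c ^ d))))) ⟩
  (∂̂ c ⊛ (c ^ suc d)) ⊕ (k · ((c ⊛ ∂̂ c) ⊛ (c ^ d)))
    ≈⟨ ≋-⊕ ≋-refl (≋-· k (≋-⊛ʳ (c ^ d) (⊛-comm-deg2-deg1 c (∂̂ c) hc (homogeneous-∂̂ hc)))) ⟩
  (∂̂ c ⊛ (c ^ suc d)) ⊕ (k · ((∂̂ c ⊛ c) ⊛ (c ^ d)))
    ≈⟨ ≃⇒≋ (⊕-cong ≃-refl (·-cong k (⊛-assoc (∂̂ c) c (c ^ d)))) ⟩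
  (∂̂ c ⊛ (c ^ suc d)) ⊕ (k · (∂̂ c ⊛ (c ^ suc d)))
    ≈⟨ ≃⇒≋ (⊕-·-collect k (∂̂ c ⊛ (c ^ suc d))) ⟩
  (1ℚ + k) · (∂̂ c ⊛ (c ^ suc d))
    ≡⟨ cong (_· (∂̂ c ⊛ (c ^ suc d))) (ℕ→ℚ-suc (suc d)) ⟨
  ℕ→ℚ (suc (suc d)) · (∂̂ c ⊛ (c ^ suc d))
    ∎
  where
  open ≋-Reasoning
  k = ℕ→ℚ (suc d)

[xy]y≋[] : ∀ {n} (x y : Poly n) → Homogeneous 1 y → (x ⊛ y) ⊛ y ≋ []
[xy]y≋[] x y hy = begin
  (x ⊛ y) ⊛ y    ≈⟨ ≃⇒≋ (⊛-assoc x y y) ⟩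
  x ⊛ (y ⊛ y)    ≈⟨ ≋-⊛ˡ x (square-deg1≋[] y hy) ⟩
  x ⊛ []         ≈⟨ ≃⇒≋ (⊛-[] x) ⟩
  []             ∎
  where open ≋-Reasoning

[xy]x≋[] : ∀ {n} (x y : Poly n) → Homogeneous 1 x → Homogeneous 1 y → (x ⊛ y) ⊛ x ≋ []
[xy]x≋[] x y hx hy = begin
  (x ⊛ y) ⊛ x    ≈⟨ ⊛-comm-deg2-deg1 (x ⊛ y) x (homogeneous-⊛ hx hy) hx ⟩
  x ⊛ (x ⊛ y)    ≈⟨ ≃⇒≋ (≃-sym (⊛-assoc x x y)) ⟩
  (x ⊛ x) ⊛ y    ≈⟨ ≋-⊛ʳ y (square-deg1≋[] x hx) ⟩
  []             ∎
  where open ≋-Reasoning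

[xy]⊛lincomb≋[] : ∀ {n} (x y : Poly n) → Homogeneous 1 x → Homogeneous 1 y →
  ∀ α β → (x ⊛ y) ⊛ ((α · x) ⊕ (β · y)) ≋ []
[xy]⊛lincomb≋[] x y hx hy α β = begin
  (x ⊛ y) ⊛ ((α · x) ⊕ (β · y))
    ≈⟨ ≃⇒≋ (⊛-lincomb (x ⊛ y) α β x y) ⟩
  (α · ((x ⊛ y) ⊛ x)) ⊕ (β · ((x ⊛ y) ⊛ y))
    ≈⟨ ≋-⊕ (≋-· α ([xy]x≋[] x y hx hy)) (≋-· β ([xy]y≋[] x y hy)) ⟩
  []
    ∎
  where open ≋-Reasoning

∂̂-⊛-^ : ∀ {n k} (p c : Poly n) → Homogeneous k p → Homogeneous 2 c → p ⊛ ∂̂ c ≋ [] →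
  ∀ d → ∂̂ (p ⊛ (c ^ d)) ≋ ∂̂ p ⊛ (c ^ d)
∂̂-⊛-^ {k = k} p c hp hc p∂̂c≋[] d = begin
  ∂̂ (p ⊛ (c ^ d))                                    ≈⟨ ≃⇒≋ (∂̂-⊛ p (c ^ d) hp) ⟩
  (∂̂ p ⊛ (c ^ d)) ⊕ (sgn k · (p ⊛ ∂̂ (c ^ d)))        ≈⟨ ≋-⊕ ≋-refl (≋-· (sgn k) (p⊛∂̂c^d≋[] d)) ⟩
  (∂̂ p ⊛ (c ^ d)) ⊕ []                               ≈⟨ ≃⇒≋ (⊕-identityʳ _) ⟩
  ∂̂ p ⊛ (c ^ d)                                      ∎
  where
  open ≋-Reasoning
  p⊛∂̂c^d≋[] : ∀ d → p ⊛ ∂̂ (c ^ d) ≋ []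
  p⊛∂̂c^d≋[] zero    = ≃⇒≋ (⊛-[] p)
  p⊛∂̂c^d≋[] (suc d) = begin
    p ⊛ ∂̂ (c ^ suc d)
      ≈⟨ ≋-⊛ˡ p (∂̂-^ c hc d) ⟩
    p ⊛ (ℕ→ℚ (suc d) · (∂̂ c ⊛ (c ^ d)))
      ≈⟨ ≃⇒≋ (⊛-·ʳ p (ℕ→ℚ (suc d)) _) ⟩
    ℕ→ℚ (suc d) · (p ⊛ (∂̂ c ⊛ (c ^ d)))
      ≈⟨ ≃⇒≋ (·-cong (ℕ→ℚ (suc d)) (≃-sym (⊛-assoc p (∂̂ c) (c ^ d)))) ⟩
    ℕ→ℚ (suc d) · ((p ⊛ ∂̂ c) ⊛ (c ^ d))
      ≈⟨ ≋-· (ℕ→ℚ (suc d)) (≋-⊛ʳ (c ^ d) p∂̂c≋[]) ⟩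
    []
      ∎

-- The elements a, m and c

-- With irrelevant proof arguments, genℕ n i j does not depend on them definitionally.
genℕ : ∀ n (i j : ℕ) → .(i < j) → .(j ≤ n) → Gen n
genℕ n i j i<j j≤n = gen (fromℕ< (s≤s (ℕP.≤-trans (ℕP.<⇒≤ i<j) j≤n))) (fromℕ< (s≤s j≤n))
  (subst₂ _<_ (sym (FinP.toℕ-fromℕ< _)) (sym (FinP.toℕ-fromℕ< _)) (recompute (i <? j) i<j))

gen-cong : ∀ {n} {i i′ j j′ : Fin (suc n)} {i<j : toℕ i < toℕ j} {i′<j′ : toℕ i′ < toℕ j′} →
  toℕ i ≡ toℕ i′ → toℕ j ≡ toℕ j′ → gen i j i<j ≡ gen i′ j′ i′<j′
gen-cong {i = i} {i′} {j} {j′} i≡ j≡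
  with FinP.toℕ-injective {i = i} {i′} i≡ | FinP.toℕ-injective {i = j} {j′} j≡
... | refl | refl = cong (gen i j) (ℕP.<-irrelevant _ _)

gen≡genℕ : ∀ {n} {i j : Fin (suc n)} {i<j : toℕ i < toℕ j} {i′ j′ : ℕ} .(i′<j′ : i′ < j′) .(j′≤n : j′ ≤ n) →
  toℕ i ≡ i′ → toℕ j ≡ j′ → gen i j i<j ≡ genℕ n i′ j′ i′<j′ j′≤n
gen≡genℕ _ _ i≡ j≡ = gen-cong (trans i≡ (sym (FinP.toℕ-fromℕ< _))) (trans j≡ (sym (FinP.toℕ-fromℕ< _)))

ifBelow : ∀ n → ((i : ℕ) → .(i < n) → ℚ) → ℕ → ℚ
ifBelow n G i with i <? n
... | yes i<n = G i i<n
... | no  _   = 0ℚ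

ifBelow-yes : ∀ n G {i} (i<n : i < n) → ifBelow n G i ≡ G i i<n
ifBelow-yes n G {i} i<n with i <? n
... | yes _   = refl
... | no  i≮n = contradiction i<n i≮n

ifBelow-no : ∀ n G {i} → ¬ i < n → ifBelow n G i ≡ 0ℚ
ifBelow-no n G {i} i≮n with i <? n
... | yes i<n = contradiction i<n i≮n
... | no  _   = refl

ifTriangle : ∀ n → ((i j : ℕ) → .(i < j) → .(j < n) → ℚ) → ℕ → ℕ → ℚ
ifTriangle n G i j with i <? j | j <? n
... | yes i<j | yes j<n = G i j i<j j<n
... | _       | _       = 0ℚ

ifTriangle-yes : ∀ n G {i j} → (i<j : i < j) (j<n : j < n) → ifTriangle n G i j ≡ G i j i<j j<n
ifTriangle-yes n G {i} {j} i<j j<n with i <? j | j <? n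
... | yes _   | yes _   = refl
... | no  i≮j | _       = contradiction i<j i≮j
... | yes _   | no  j≮n = contradiction j<n j≮n

ifTriangle-no : ∀ n G i j → ¬ (i < j × j < n) → ifTriangle n G i j ≡ 0ℚ
ifTriangle-no n G i j out with i <? j | j <? n
... | yes i<j | yes j<n = contradiction (i<j , j<n) out
... | yes _   | no  _   = refl
... | no  _   | _       = refl

-- Defs builds aOS, mOS and cOS from summands local to where-blocks, which Agda does not
-- export; unification against their definitional unfoldings names them here.  For the
-- inner sums only `tabulate Fin.suc` works, as the j = 0 summand already reduces to [].
aRow : ∀ n → Σ (Fin (suc n) → Poly n) λ row → aOS n ≡ concatMap row (allFin (suc n))
aRow n = _ , refl

aEntry-def : ∀ n i → Σ (Fin (suc n) → Poly n) λ entry → proj₁ (aRow n) i ≡ concatMap entry (tabulate Fin.suc)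
aEntry-def n i = _ , refl

aEntry : ∀ n → Fin (suc n) → Fin (suc n) → Poly n
aEntry n i = proj₁ (aEntry-def n i)

cRow : ∀ n → Σ (Fin (suc n) → Poly n) λ row → cOS n ≡ concatMap row (allFin (suc n))
cRow n = _ , refl

cEntry-def : ∀ n i → Σ (Fin (suc n) → Poly n) λ entry → proj₁ (cRow n) i ≡ concatMap entry (tabulate Fin.suc)
cEntry-def n i = _ , refl

cEntry : ∀ n → Fin (suc n) → Fin (suc n) → Poly n
cEntry n i = proj₁ (cEntry-def n i)

mEntry-def : ∀ n → Σ (Fin (suc n) → Poly n) λ entry → mOS n ≡ concatMap entry (allFin (suc n))
mEntry-def n = _ , refl

mEntry : ∀ n → Fin (suc n) → Poly n
mEntry n = proj₁ (mEntry-def n)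

aTerm : ∀ n → (Word n → ℚ) → ℕ → ℕ → ℚ
aTerm n F = ifTriangle n λ i j i<j j<n → F (genℕ n i j i<j (ℕP.<⇒≤ j<n) ∷ [])

mTerm : ∀ n → (Word n → ℚ) → ℕ → ℚ
mTerm n F = ifBelow n λ i i<n → F (genℕ n i n i<n ℕP.≤-refl ∷ [])

cTerm : ∀ n → (Word n → ℚ) → ℕ → ℕ → ℚ
cTerm n F = ifTriangle n λ i j i<j j<n →
    F (genℕ n i j i<j (ℕP.<⇒≤ j<n) ∷ genℕ n i n (ℕP.<-trans i<j j<n) ℕP.≤-refl ∷ [])
  + F (genℕ n i j i<j (ℕP.<⇒≤ j<n) ∷ genℕ n j n j<n ℕP.≤-refl ∷ [])

⟦aEntry⟧ : ∀ n F i j → ⟦ aEntry n i j ⟧ F ≡ aTerm n F (toℕ i) (toℕ j)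
⟦aEntry⟧ n F i j with toℕ i <? toℕ j | toℕ j <? n
... | yes i<j | yes j<n =
  trans (⟦⟧-mono _ F) (cong (λ g → F (g ∷ [])) (gen≡genℕ i<j (ℕP.<⇒≤ j<n) refl refl))
... | yes _ | no  _ = refl
... | no  _ | _     = refl

⟦mEntry⟧ : ∀ n F i → ⟦ mEntry n i ⟧ F ≡ mTerm n F (toℕ i)
⟦mEntry⟧ n F i with toℕ i <? n
... | yes i<n =
  trans (⟦⟧-mono _ F) (cong (λ g → F (g ∷ [])) (gen≡genℕ i<n ℕP.≤-refl refl (FinP.toℕ-fromℕ n)))
... | no  _ = refl

⟦cEntry⟧ : ∀ n F i j → ⟦ cEntry n i j ⟧ F ≡ cTerm n F (toℕ i) (toℕ j)
⟦cEntry⟧ n F i j with toℕ i <? toℕ j | toℕ j <? n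
... | yes i<j | yes j<n = trans
  (solve 2 (λ a b → (con 1ℚ :* con 1ℚ) :* a :+ ((con 1ℚ :* con 1ℚ) :* b :+ con 0ℚ) := a :+ b) refl
     (F (gen i j i<j ∷ eLast i (ℕP.<-trans i<j j<n) ∷ [])) (F (gen i j i<j ∷ eLast j j<n ∷ [])))
  (cong₂ _+_ (cong₂ (λ g h → F (g ∷ h ∷ [])) (gen≡genℕ i<j (ℕP.<⇒≤ j<n) refl refl)
                                             (gen≡genℕ (ℕP.<-trans i<j j<n) ℕP.≤-refl refl (FinP.toℕ-fromℕ n)))
             (cong₂ (λ g h → F (g ∷ h ∷ [])) (gen≡genℕ i<j (ℕP.<⇒≤ j<n) refl refl)
                                             (gen≡genℕ j<n ℕP.≤-refl refl (FinP.toℕ-fromℕ n))))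
... | yes _ | no  _ = refl
... | no  _ | _     = refl

aEntry-homogeneous : ∀ n i j → Homogeneous 1 (aEntry n i j)
aEntry-homogeneous n i j with toℕ i <? toℕ j | toℕ j <? n
... | yes _ | yes _ = refl ∷ []
... | yes _ | no  _ = []
... | no  _ | _     = []

mEntry-homogeneous : ∀ n i → Homogeneous 1 (mEntry n i)
mEntry-homogeneous n i with toℕ i <? n
... | yes _ = refl ∷ []
... | no  _ = []

cEntry-homogeneous : ∀ n i j → Homogeneous 2 (cEntry n i j)
cEntry-homogeneous n i j with toℕ i <? toℕ j | toℕ j <? n
... | yes _ | yes _ = refl ∷ refl ∷ []
... | yes _ | no  _ = []
... | no  _ | _     = []

aOS-homogeneous : ∀ n → Homogeneous 1 (aOS n)
aOS-homogeneous n = homogeneous-concatMap-tabulate _ id λ i →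
  homogeneous-concatMap-tabulate (aEntry n i) id (aEntry-homogeneous n i)

mOS-homogeneous : ∀ n → Homogeneous 1 (mOS n)
mOS-homogeneous n = homogeneous-concatMap-tabulate (mEntry n) id (mEntry-homogeneous n)

cOS-homogeneous : ∀ n → Homogeneous 2 (cOS n)
cOS-homogeneous n = homogeneous-concatMap-tabulate _ id λ i →
  homogeneous-concatMap-tabulate (cEntry n i) id (cEntry-homogeneous n i)

⟦⟧-triangular : ∀ n (E : Fin (suc n) → Fin (suc n) → Poly n) (V : ℕ → ℕ → ℚ) F →
  (∀ i j → ⟦ E i j ⟧ F ≡ V (toℕ i) (toℕ j)) → (∀ i j → ¬ (i < j × j < n) → V i j ≡ 0ℚ) →
  ⟦ concatMap (λ i → concatMap (E i) (allFin (suc n))) (allFin (suc n)) ⟧ F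
    ≡ sumBelow n (λ j → sumBelow j (λ i → V i j))
⟦⟧-triangular n E V F ⟦E⟧ V≡0 = trans
  (⟦⟧-concatMap-tabulate (suc n) (λ i → concatMap (E i) (allFin (suc n))) id (λ i → sumBelow (suc n) (V i)) F
     (λ i → ⟦⟧-concatMap-tabulate (suc n) (E i) id (V (toℕ i)) F (⟦E⟧ i)))
  (sumBelow-triangle n V V≡0)

⟦aOS⟧ : ∀ n F → ⟦ aOS n ⟧ F ≡ sumBelow n (λ j → sumBelow j (λ i → aTerm n F i j))
⟦aOS⟧ n F = ⟦⟧-triangular n (aEntry n) (aTerm n F) F (⟦aEntry⟧ n F) (ifTriangle-no n _)

⟦cOS⟧ : ∀ n F → ⟦ cOS n ⟧ F ≡ sumBelow n (λ j → sumBelow j (λ i → cTerm n F i j))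
⟦cOS⟧ n F = ⟦⟧-triangular n (cEntry n) (cTerm n F) F (⟦cEntry⟧ n F) (ifTriangle-no n _)

⟦mOS⟧ : ∀ n F → ⟦ mOS n ⟧ F ≡ sumBelow n (mTerm n F)
⟦mOS⟧ n F = begin
  ⟦ mOS n ⟧ F
    ≡⟨ ⟦⟧-concatMap-tabulate (suc n) (mEntry n) id (mTerm n F) F (⟦mEntry⟧ n F) ⟩
  sumBelow (suc n) (mTerm n F)
    ≡⟨ sumBelow-suc n (mTerm n F) ⟩
  sumBelow n (mTerm n F) + mTerm n F n
    ≡⟨ cong (sumBelow n (mTerm n F) +_) (ifBelow-no n _ (ℕP.n≮n n)) ⟩
  sumBelow n (mTerm n F) + 0ℚ
    ≡⟨ ℚP.+-identityʳ _ ⟩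
  sumBelow n (mTerm n F)
    ∎
  where open ≡-Reasoning

-- Derivatives of a, m, c and g

coeffSum-aOS : ∀ n → coeffSum (aOS n) ≡ ℕ→ℚ (n C 2)
coeffSum-aOS n = begin
  coeffSum (aOS n)
    ≡⟨ ⟦aOS⟧ n (λ _ → 1ℚ) ⟩
  sumBelow n (λ j → sumBelow j (λ i → aTerm n (λ _ → 1ℚ) i j))
    ≡⟨ sumBelow-cong< n (λ j j<n → trans (sumBelow-cong< j (λ i i<j → ifTriangle-yes n _ i<j j<n)) (sumBelow-1 j)) ⟩
  sumBelow n ℕ→ℚ
    ≡⟨ sumBelow-id n ⟩
  ℕ→ℚ (n C 2)
    ∎
  where open ≡-Reasoning

coeffSum-mOS : ∀ n → coeffSum (mOS n) ≡ ℕ→ℚ n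
coeffSum-mOS n =
  trans (⟦mOS⟧ n (λ _ → 1ℚ)) (trans (sumBelow-cong< n (λ i i<n → ifBelow-yes n _ i<n)) (sumBelow-1 n))

∂̂aOS : ∀ n → ∂̂ (aOS n) ≃ const (ℕ→ℚ (n C 2))
∂̂aOS n = subst (λ r → ∂̂ (aOS n) ≃ const r) (coeffSum-aOS n) (∂̂-deg1 (aOS n) (aOS-homogeneous n))

∂̂mOS : ∀ n → ∂̂ (mOS n) ≃ const (ℕ→ℚ n)
∂̂mOS n = subst (λ r → ∂̂ (mOS n) ≃ const r) (coeffSum-mOS n) (∂̂-deg1 (mOS n) (mOS-homogeneous n))

∂̂[aOS⊛mOS] : ∀ n → ∂̂ (aOS n ⊛ mOS n) ≃ ((- ℕ→ℚ n) · aOS n) ⊕ (ℕ→ℚ (n C 2) · mOS n)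
∂̂[aOS⊛mOS] n = subst₂ (λ α β → ∂̂ (aOS n ⊛ mOS n) ≃ (α · aOS n) ⊕ (β · mOS n))
  (cong -_ (coeffSum-mOS n)) (coeffSum-aOS n)
  (∂̂-deg1-⊛ (aOS n) (mOS n) (aOS-homogeneous n) (mOS-homogeneous n))

cTerm-∂w : ∀ n F {i j} → i < j → j < n →
  cTerm n (λ u → ⟦ ∂w u ⟧ F) i j ≡ (mTerm n F i + mTerm n F j) + (- ℕ→ℚ 2) * aTerm n F i j
cTerm-∂w n F {i} {j} i<j j<n = begin
  cTerm n (λ u → ⟦ ∂w u ⟧ F) i j
    ≡⟨ ifTriangle-yes n _ i<j j<n ⟩
  (1ℚ * Mi + ((- 1ℚ) * A + 0ℚ)) + (1ℚ * Mj + ((- 1ℚ) * A + 0ℚ))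
    ≡⟨ solve 3 (λ mi mj a → (con 1ℚ :* mi :+ (con (- 1ℚ) :* a :+ con 0ℚ))
                            :+ (con 1ℚ :* mj :+ (con (- 1ℚ) :* a :+ con 0ℚ))
                          := (mi :+ mj) :+ con (- ℕ→ℚ 2) :* a) refl Mi Mj A ⟩
  (Mi + Mj) + (- ℕ→ℚ 2) * A
    ≡⟨ cong₂ (λ x y → x + (- ℕ→ℚ 2) * y)
             (cong₂ _+_ (ifBelow-yes n _ (ℕP.<-trans i<j j<n)) (ifBelow-yes n _ j<n)) (ifTriangle-yes n _ i<j j<n) ⟨
  (mTerm n F i + mTerm n F j) + (- ℕ→ℚ 2) * aTerm n F i j
    ∎
  where
  open ≡-Reasoning
  Mi = F (genℕ n i n (ℕP.<-trans i<j j<n) ℕP.≤-refl ∷ [])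
  Mj = F (genℕ n j n j<n ℕP.≤-refl ∷ [])
  A  = F (genℕ n i j i<j (ℕP.<⇒≤ j<n) ∷ [])

∂̂cOS : ∀ n → ∂̂ (cOS n) ≃ ((- ℕ→ℚ 2) · aOS n) ⊕ ((ℕ→ℚ n - 1ℚ) · mOS n)
∂̂cOS n = mk≃ λ F → begin
  ⟦ ∂̂ (cOS n) ⟧ F
    ≡⟨ trans (⟦⟧-∂̂ (cOS n) F) (⟦cOS⟧ n _) ⟩
  sumBelow n (λ j → sumBelow j (λ i → cTerm n (λ u → ⟦ ∂w u ⟧ F) i j))
    ≡⟨ sumBelow-cong< n (λ j j<n → sumBelow-cong< j (λ i i<j → cTerm-∂w n F i<j j<n)) ⟩
  sumBelow n (λ j → sumBelow j (λ i → (M F i + M F j) + (- ℕ→ℚ 2) * A F i j))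
    ≡⟨ sumBelow-cong n (λ j → sumBelow-+* j (- ℕ→ℚ 2) (λ i → M F i + M F j) (λ i → A F i j)) ⟩
  sumBelow n (λ j → sumBelow j (λ i → M F i + M F j) + (- ℕ→ℚ 2) * sumBelow j (λ i → A F i j))
    ≡⟨ sumBelow-+* n (- ℕ→ℚ 2) (λ j → sumBelow j (λ i → M F i + M F j)) (λ j → sumBelow j (λ i → A F i j)) ⟩
  sumBelow n (λ j → sumBelow j (λ i → M F i + M F j)) + (- ℕ→ℚ 2) * sumBelow n (λ j → sumBelow j (λ i → A F i j))
    ≡⟨ cong₂ (λ x y → x + (- ℕ→ℚ 2) * y)
             (trans (sumBelow-pairs n (M F)) (cong ((ℕ→ℚ n - 1ℚ) *_) (sym (⟦mOS⟧ n F)))) (sym (⟦aOS⟧ n F)) ⟩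
  (ℕ→ℚ n - 1ℚ) * ⟦ mOS n ⟧ F + (- ℕ→ℚ 2) * ⟦ aOS n ⟧ F
    ≡⟨ ℚP.+-comm ((ℕ→ℚ n - 1ℚ) * ⟦ mOS n ⟧ F) ((- ℕ→ℚ 2) * ⟦ aOS n ⟧ F) ⟩
  (- ℕ→ℚ 2) * ⟦ aOS n ⟧ F + (ℕ→ℚ n - 1ℚ) * ⟦ mOS n ⟧ F
    ≡⟨ ⟦⟧-lincomb (- ℕ→ℚ 2) (ℕ→ℚ n - 1ℚ) (aOS n) (mOS n) F ⟨
  ⟦ ((- ℕ→ℚ 2) · aOS n) ⊕ ((ℕ→ℚ n - 1ℚ) · mOS n) ⟧ F
    ∎
  where
  open ≡-Reasoning
  M = mTerm n
  A = aTerm n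

∂̂cOS^ : ∀ n d → ∂̂ (cOS n ^ suc d) ≋ ((- (ℕ→ℚ 2 * ℕ→ℚ (suc d))) · (aOS n ⊛ (cOS n ^ d)))
                                   ⊕ ((ℕ→ℚ (suc d) * (ℕ→ℚ n - 1ℚ)) · (mOS n ⊛ (cOS n ^ d)))
∂̂cOS^ n d = begin
  ∂̂ (c ^ suc d)
    ≈⟨ ∂̂-^ c (cOS-homogeneous n) d ⟩
  k · (∂̂ c ⊛ (c ^ d))
    ≈⟨ ≃⇒≋ (·-cong k (≃-trans (⊛-cong (∂̂cOS n) (≃-refl {p = c ^ d}))
                              (lincomb-⊛ (- ℕ→ℚ 2) (ℕ→ℚ n - 1ℚ) a m (c ^ d)))) ⟩
  k · (((- ℕ→ℚ 2) · (a ⊛ (c ^ d))) ⊕ ((ℕ→ℚ n - 1ℚ) · (m ⊛ (c ^ d))))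
    ≈⟨ ≃⇒≋ (·-lincomb k (- ℕ→ℚ 2) (ℕ→ℚ n - 1ℚ) (a ⊛ (c ^ d)) (m ⊛ (c ^ d))) ⟩
  ((k * (- ℕ→ℚ 2)) · (a ⊛ (c ^ d))) ⊕ ((k * (ℕ→ℚ n - 1ℚ)) · (m ⊛ (c ^ d)))
    ≡⟨ cong (λ α → (α · (a ⊛ (c ^ d))) ⊕ ((k * (ℕ→ℚ n - 1ℚ)) · (m ⊛ (c ^ d))))
            (solve 1 (λ k → k :* (:- con (ℕ→ℚ 2)) := :- (con (ℕ→ℚ 2) :* k)) refl k) ⟩
  ((- (ℕ→ℚ 2 * k)) · (a ⊛ (c ^ d))) ⊕ ((k * (ℕ→ℚ n - 1ℚ)) · (m ⊛ (c ^ d)))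
    ∎
  where
  open ≋-Reasoning
  a = aOS n
  m = mOS n
  c = cOS n
  k = ℕ→ℚ (suc d)

∂̂[aOS⊛mOS⊛cOS^] : ∀ n d → ∂̂ ((aOS n ⊛ mOS n) ⊛ (cOS n ^ d)) ≋ ((- ℕ→ℚ n) · (aOS n ⊛ (cOS n ^ d)))
                                                            ⊕ (ℕ→ℚ (n C 2) · (mOS n ⊛ (cOS n ^ d)))
∂̂[aOS⊛mOS⊛cOS^] n d = begin
  ∂̂ ((a ⊛ m) ⊛ (c ^ d))
    ≈⟨ ∂̂-⊛-^ (a ⊛ m) c (homogeneous-⊛ ha hm) (cOS-homogeneous n) am∂̂c≋[] d ⟩
  ∂̂ (a ⊛ m) ⊛ (c ^ d)
    ≈⟨ ≃⇒≋ (≃-trans (⊛-cong (∂̂[aOS⊛mOS] n) (≃-refl {p = c ^ d}))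
                    (lincomb-⊛ (- ℕ→ℚ n) (ℕ→ℚ (n C 2)) a m (c ^ d))) ⟩
  ((- ℕ→ℚ n) · (a ⊛ (c ^ d))) ⊕ (ℕ→ℚ (n C 2) · (m ⊛ (c ^ d)))
    ∎
  where
  open ≋-Reasoning
  a = aOS n
  m = mOS n
  c = cOS n
  ha = aOS-homogeneous n
  hm = mOS-homogeneous n
  am∂̂c≋[] : (a ⊛ m) ⊛ ∂̂ c ≋ []
  am∂̂c≋[] = ≋-trans (≃⇒≋ (⊛-cong (≃-refl {p = a ⊛ m}) (∂̂cOS n)))
                    ([xy]⊛lincomb≋[] a m ha hm (- ℕ→ℚ 2) (ℕ→ℚ n - 1ℚ))

gOS : ∀ n → Poly n
gOS n = (aOS n ⊛ mOS n) ⊖ (ℕ→ℚ (suc n / 2) · cOS n)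

∂̂gOS : ∀ n → let N = ℕ→ℚ n; P = ℕ→ℚ (suc n / 2) in
  ∂̂ (gOS n) ≃ ((ℕ→ℚ 2 * P - N) · aOS n) ⊕ ((ℕ→ℚ (n C 2) - P * (N - 1ℚ)) · mOS n)
∂̂gOS n = mk≃ collect
  where
  a = aOS n
  m = mOS n
  c = cOS n
  N = ℕ→ℚ n
  P = ℕ→ℚ (suc n / 2)
  Cn = ℕ→ℚ (n C 2)
  ∂ : (Word n → ℚ) → Word n → ℚ
  ∂ F u = ⟦ ∂w u ⟧ F
  collect : ∀ F → ⟦ ∂̂ (gOS n) ⟧ F ≡ ⟦ ((ℕ→ℚ 2 * P - N) · a) ⊕ ((Cn - P * (N - 1ℚ)) · m) ⟧ F
  collect F = begin
    ⟦ ∂̂ (gOS n) ⟧ F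
      ≡⟨ ⟦⟧-∂̂ (gOS n) F ⟩
    ⟦ gOS n ⟧ (∂ F)
      ≡⟨ trans (⟦⟧-⊖ (a ⊛ m) (P · c) (∂ F))
               (cong (λ z → ⟦ a ⊛ m ⟧ (∂ F) + (- 1ℚ) * z) (⟦⟧-· P c (∂ F))) ⟩
    ⟦ a ⊛ m ⟧ (∂ F) + (- 1ℚ) * (P * ⟦ c ⟧ (∂ F))
      ≡⟨ cong₂ (λ x y → x + (- 1ℚ) * (P * y)) (sym (⟦⟧-∂̂ (a ⊛ m) F)) (sym (⟦⟧-∂̂ c F)) ⟩
    ⟦ ∂̂ (a ⊛ m) ⟧ F + (- 1ℚ) * (P * ⟦ ∂̂ c ⟧ F)
      ≡⟨ cong₂ (λ x y → x + (- 1ℚ) * (P * y))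
               (trans (⟦⟧-≡ (∂̂[aOS⊛mOS] n) F) (⟦⟧-lincomb (- N) Cn a m F))
               (trans (⟦⟧-≡ (∂̂cOS n) F) (⟦⟧-lincomb (- ℕ→ℚ 2) (N - 1ℚ) a m F)) ⟩
    ((- N) * A + Cn * M) + (- 1ℚ) * (P * ((- ℕ→ℚ 2) * A + (N - 1ℚ) * M))
      ≡⟨ solve 5 (λ N P C A M → ((:- N) :* A :+ C :* M)
                                  :+ con (- 1ℚ) :* (P :* ((:- con (ℕ→ℚ 2)) :* A :+ (N :- con 1ℚ) :* M))
                              := (con (ℕ→ℚ 2) :* P :- N) :* A :+ (C :- P :* (N :- con 1ℚ)) :* M)
                 refl N P Cn A M ⟩
    (ℕ→ℚ 2 * P - N) * A + (Cn - P * (N - 1ℚ)) * M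
      ≡⟨ ⟦⟧-lincomb (ℕ→ℚ 2 * P - N) (Cn - P * (N - 1ℚ)) a m F ⟨
    ⟦ ((ℕ→ℚ 2 * P - N) · a) ⊕ ((Cn - P * (N - 1ℚ)) · m) ⟧ F
      ∎
    where
    open ≡-Reasoning
    A = ⟦ a ⟧ F
    M = ⟦ m ⟧ F

nC2≡½n[n-1] : ∀ n → ℕ→ℚ (n C 2) ≡ ½ * (ℕ→ℚ n * (ℕ→ℚ n - 1ℚ))
nC2≡½n[n-1] n = trans (solve 1 (λ c → c := con ½ :* (con (ℕ→ℚ 2) :* c)) refl (ℕ→ℚ (n C 2)))
                      (cong (½ *_) (2*nC2≡n[n-1] n))

∂̂gOS-even : ∀ n → 2 ∣ n → ∂̂ (gOS n) ≋ zeroP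
∂̂gOS-even n 2∣n = ≃⇒≋ (≃-trans (∂̂gOS n) (mk≃ λ F → begin
  ⟦ (α · aOS n) ⊕ (β · mOS n) ⟧ F
    ≡⟨ ⟦⟧-lincomb α β (aOS n) (mOS n) F ⟩
  α * ⟦ aOS n ⟧ F + β * ⟦ mOS n ⟧ F
    ≡⟨ cong₂ (λ x y → x * ⟦ aOS n ⟧ F + y * ⟦ mOS n ⟧ F) (proj₁ α≡0×β≡0) (proj₂ α≡0×β≡0) ⟩
  0ℚ * ⟦ aOS n ⟧ F + 0ℚ * ⟦ mOS n ⟧ F
    ≡⟨ solve 2 (λ x y → con 0ℚ :* x :+ con 0ℚ :* y := con 0ℚ) refl (⟦ aOS n ⟧ F) (⟦ mOS n ⟧ F) ⟩
  0ℚ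
    ∎))
  where
  open ≡-Reasoning
  N = ℕ→ℚ n
  P = ℕ→ℚ (suc n / 2)
  α = ℕ→ℚ 2 * P - N
  β = ℕ→ℚ (n C 2) - P * (N - 1ℚ)
  coefficients : ∀ {N′ C′} → N′ ≡ P * ℕ→ℚ 2 → C′ ≡ ½ * (N′ * (N′ - 1ℚ)) →
    (ℕ→ℚ 2 * P - N′ ≡ 0ℚ) × (C′ - P * (N′ - 1ℚ) ≡ 0ℚ)
  coefficients refl refl =
      solve 1 (λ p → con (ℕ→ℚ 2) :* p :- p :* con (ℕ→ℚ 2) := con 0ℚ) refl P
    , solve 1 (λ p → con ½ :* ((p :* con (ℕ→ℚ 2)) :* (p :* con (ℕ→ℚ 2) :- con 1ℚ))
                     :- p :* (p :* con (ℕ→ℚ 2) :- con 1ℚ)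
                   := con 0ℚ) refl P
  α≡0×β≡0 : (α ≡ 0ℚ) × (β ≡ 0ℚ)
  α≡0×β≡0 = coefficients (ℕ→ℚ-even 2∣n) (nC2≡½n[n-1] n)

∂̂gOS-odd : ∀ n → ¬ 2 ∣ n → ∂̂ (gOS n) ≋ (aOS n ⊖ ((ℕ→ℚ (suc n / 2) - 1ℚ) · mOS n))
∂̂gOS-odd n 2∤n = ≃⇒≋ (≃-trans (∂̂gOS n) (mk≃ λ F → begin
  ⟦ (α · aOS n) ⊕ (β · mOS n) ⟧ F
    ≡⟨ ⟦⟧-lincomb α β (aOS n) (mOS n) F ⟩
  α * ⟦ aOS n ⟧ F + β * ⟦ mOS n ⟧ F
    ≡⟨ cong₂ (λ x y → x * ⟦ aOS n ⟧ F + y * ⟦ mOS n ⟧ F) (proj₁ α≡1×β≡1-P) (proj₂ α≡1×β≡1-P) ⟩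
  1ℚ * ⟦ aOS n ⟧ F + (- (P - 1ℚ)) * ⟦ mOS n ⟧ F
    ≡⟨ solve 3 (λ p x y → con 1ℚ :* x :+ (:- (p :- con 1ℚ)) :* y := x :+ con (- 1ℚ) :* ((p :- con 1ℚ) :* y))
               refl P (⟦ aOS n ⟧ F) (⟦ mOS n ⟧ F) ⟩
  ⟦ aOS n ⟧ F + (- 1ℚ) * ((P - 1ℚ) * ⟦ mOS n ⟧ F)
    ≡⟨ trans (⟦⟧-⊖ (aOS n) ((P - 1ℚ) · mOS n) F)
             (cong (λ z → ⟦ aOS n ⟧ F + (- 1ℚ) * z) (⟦⟧-· (P - 1ℚ) (mOS n) F)) ⟨
  ⟦ aOS n ⊖ ((P - 1ℚ) · mOS n) ⟧ F
    ∎))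
  where
  open ≡-Reasoning
  N = ℕ→ℚ n
  P = ℕ→ℚ (suc n / 2)
  α = ℕ→ℚ 2 * P - N
  β = ℕ→ℚ (n C 2) - P * (N - 1ℚ)
  coefficients : ∀ {N′ C′} → N′ ≡ P * ℕ→ℚ 2 - 1ℚ → C′ ≡ ½ * (N′ * (N′ - 1ℚ)) →
    (ℕ→ℚ 2 * P - N′ ≡ 1ℚ) × (C′ - P * (N′ - 1ℚ) ≡ - (P - 1ℚ))
  coefficients refl refl =
      solve 1 (λ p → con (ℕ→ℚ 2) :* p :- (p :* con (ℕ→ℚ 2) :- con 1ℚ) := con 1ℚ) refl P
    , solve 1 (λ p → con ½ :* ((p :* con (ℕ→ℚ 2) :- con 1ℚ) :* ((p :* con (ℕ→ℚ 2) :- con 1ℚ) :- con 1ℚ))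
                     :- p :* ((p :* con (ℕ→ℚ 2) :- con 1ℚ) :- con 1ℚ)
                   := :- (p :- con 1ℚ)) refl P
  α≡1×β≡1-P : (α ≡ 1ℚ) × (β ≡ - (P - 1ℚ))
  α≡1×β≡1-P = coefficients (ℕ→ℚ-odd 2∤n) (nC2≡½n[n-1] n)

lemma5p7 : (n : ℕ) → 2 ≤ n →
    let a = aOS n
        m = mOS n
        c = cOS n
        p = suc n / 2
        g = (a ⊛ m) ⊖ (ℕ→ℚ p · c)
    in (∂̂ a ≈OS const (ℕ→ℚ (n C 2)))
     × (∂̂ m ≈OS const (ℕ→ℚ n))
     × (∂̂ (a ⊛ m) ≈OS ((- ℕ→ℚ n) · a) ⊕ (ℕ→ℚ (n C 2) · m))
     × (∀ (d : ℕ) → 1 ≤ d →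
          ∂̂ (c ^ d) ≈OS ((- (ℕ→ℚ 2 * ℕ→ℚ d)) · (a ⊛ (c ^ (d ∸ 1))))
                        ⊕ ((ℕ→ℚ d * (ℕ→ℚ n - 1ℚ)) · (m ⊛ (c ^ (d ∸ 1)))))
     × (∀ (d : ℕ) →
          ∂̂ ((a ⊛ m) ⊛ (c ^ d)) ≈OS ((- ℕ→ℚ n) · (a ⊛ (c ^ d)))
                                    ⊕ (ℕ→ℚ (n C 2) · (m ⊛ (c ^ d))))
     × (2 ∣ n → ∂̂ g ≈OS zeroP)
     × (¬ (2 ∣ n) → ∂̂ g ≈OS (a ⊖ ((ℕ→ℚ p - 1ℚ) · m)))
lemma5p7 n _ =
    ≋⇒≈OS (≃⇒≋ (∂̂aOS n))
  , ≋⇒≈OS (≃⇒≋ (∂̂mOS n))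
  , ≋⇒≈OS (≃⇒≋ (∂̂[aOS⊛mOS] n))
  , (λ { (suc d) _ → ≋⇒≈OS (∂̂cOS^ n d) })
  , (λ d → ≋⇒≈OS (∂̂[aOS⊛mOS⊛cOS^] n d))
  , (λ 2∣n → ≋⇒≈OS (∂̂gOS-even n 2∣n))
  , (λ 2∤n → ≋⇒≈OS (∂̂gOS-odd n 2∤n))
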